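{- There exist infinitely many near-triangulations $G$ with minimum degree at least $3$ such that $\gamma(G) = 3|V(G)|/10$.
   Context: A near-triangulation is a 2-connected plane graph in which every bounded face is bounded by a triangle. $\gamma(G)$ is the minimum size of a dominating set of $G$ (a vertex set $S$ such that every vertex is in $S$ or adjacent to a vertex of $S$). -}

module Defs where

open import Data.Nat using (ℕ; zero; suc; _+_; _*_; _≤_; _<_)
open import Data.Fin using (Fin)
open import Data.Fin.Subset using (Subset; _∈_; ∣_∣)
open import Data.Fin.Permutation using (Permutation′; _⟨$⟩ʳ_)
open import Data.Product using (Σ; ∃; ∃-syntax; _×_; _,_)
open import Data.Sum using (_⊎_)
open import Relation.Nullary using (¬_)
open import Relation.Binary.PropositionalEquality using (_≡_; _≢_)

-- Plane graphs are represented combinatorially by (genus 0) combinatorial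
-- maps / rotation systems:
--   * darts  Fin d, with a fixed-point-free involution α (the two halves
--     of an edge) and a permutation σ (rotation: cyclic order of darts
--     around each vertex);
--   * vertices are the σ-orbits, labelled by Fin n via  vert;
--   * faces are the orbits of φ = σ ∘ α, labelled by Fin f via  face;
--   * the embedding is in the plane (sphere) iff Euler's formula
--     n - e + f = 2 holds (e = d/2 edges), for a connected map.

iter : ∀ {A : Set} → (A → A) → ℕ → A → A
iter g zero    x = x
iter g (suc k) x = g (iter g k x)

SameOrbit : ∀ {d} → (Fin d → Fin d) → Fin d → Fin d → Set
SameOrbit g x y = ∃[ k ] iter g k x ≡ y

record PlaneGraph : Set where
  field
    n d f : ℕ
    α     : Fin d → Fin d
    σ     : Permutation′ d
    vert  : Fin d → Fin n
    face  : Fin d → Fin f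
    α-invol : ∀ x → α (α x) ≡ x
    α-fpf   : ∀ x → α x ≢ x
    vert-surj  : ∀ v → ∃[ x ] vert x ≡ v
    vert-orbit : ∀ x y → vert x ≡ vert y → SameOrbit (σ ⟨$⟩ʳ_) x y
    orbit-vert : ∀ x y → SameOrbit (σ ⟨$⟩ʳ_) x y → vert x ≡ vert y
    face-surj  : ∀ o → ∃[ x ] face x ≡ o
    face-orbit : ∀ x y → face x ≡ face y → SameOrbit (λ z → σ ⟨$⟩ʳ α z) x y
    orbit-face : ∀ x y → SameOrbit (λ z → σ ⟨$⟩ʳ α z) x y → face x ≡ face y
    loopless   : ∀ x → vert (α x) ≢ vert x
    no-multi   : ∀ x y → vert x ≡ vert y → vert (α x) ≡ vert (α y) → x ≡ y
    -- Euler's formula n - d/2 + f = 2 (genus 0, i.e. plane embedding)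
    euler      : 2 * n + 2 * f ≡ d + 4

  φ : Fin d → Fin d
  φ z = σ ⟨$⟩ʳ α z

  Adj : Fin n → Fin n → Set
  Adj u v = ∃[ x ] (vert x ≡ u × vert (α x) ≡ v)

open PlaneGraph public

data Walk (G : PlaneGraph) (P : Fin (n G) → Set) : Fin (n G) → Fin (n G) → Set where
  here : ∀ {u} → P u → Walk G P u u
  step : ∀ {u v w} → P u → Adj G u v → Walk G P v w → Walk G P u w

TwoConnected : PlaneGraph → Set
TwoConnected G =
  3 ≤ n G ×
  (∀ w u v → u ≢ w → v ≢ w → Walk G (λ z → z ≢ w) u v)

TriangularFaceAt : (G : PlaneGraph) → Fin (d G) → Set
TriangularFaceAt G x =
  φ G x ≢ x × φ G (φ G x) ≢ x × φ G (φ G (φ G x)) ≡ x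

IsNearTriangulation : PlaneGraph → Set
IsNearTriangulation G =
  TwoConnected G ×
  Σ (Fin (f G)) λ o → ∀ x → face G x ≢ o → TriangularFaceAt G x

MinDegree≥3 : PlaneGraph → Set
MinDegree≥3 G = ∀ v → Σ (Fin (n G)) λ a → Σ (Fin (n G)) λ b → Σ (Fin (n G)) λ c →
  Adj G v a × Adj G v b × Adj G v c × a ≢ b × a ≢ c × b ≢ c

Dominating : (G : PlaneGraph) → Subset (n G) → Set
Dominating G S = ∀ v → v ∈ S ⊎ (∃[ u ] (u ∈ S × Adj G u v))

DominationNumber : PlaneGraph → ℕ → Set
DominationNumber G k =
  (Σ (Subset (n G)) λ S → Dominating G S × ∣ S ∣ ≡ k) ×
  (∀ S → Dominating G S → k ≤ ∣ S ∣)

-- Each graph of the family is a chain of k + 1 blocks. A block consists of two copies, top and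
-- bottom, of a 10-vertex near-triangulation H in which only the vertices 3 and 5 have neighbours
-- outside their copy: inside a block the vertices 3 and 5 of the two copies span two link
-- triangles, and consecutive blocks are joined by two crossing triangles. The result is a
-- near-triangulation with n = 20(k + 1) vertices and minimum degree 3. It is given by an explicit
-- rotation system; listing every vertex and face orbit by a base dart, the position of each dart
-- and the orbit length yields the orbit conditions and the inverse rotation by computation.
-- Every vertex except the two ends of one link edge has two distinct neighbours of smaller rank,
-- which gives 2-connectivity, and in a simple graph of minimum degree 3 every face orbit of length
-- three is a triangle.
-- An exhaustive search shows that the eight vertices of H other than 3 and 5 cannot be dominated
-- by fewer than three vertices of H, while {0, 2, 6} dominates H. Since the closed neighbourhoods
-- of those eight vertices stay inside their copy, every dominating set has at least
-- 6(k + 1) = 3n/10 vertices, and the copies of {0, 2, 6} form a dominating set of that size.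

module Submission where

open import Defs
open import Data.Nat using (ℕ; zero; suc; _+_; _*_; _∸_; _≤_; _<_; _<?_; s≤s; z≤n; s≤s⁻¹)
open import Data.Nat.Properties
  using (+-comm; *-suc; *-zeroʳ; +-mono-≤; +-monoʳ-<; <-≤-trans; <⇒≢; ≮⇒≥; ≤-trans; n<1+n; n≤1+n; m≤m+n; m≤m*n;
         module ≤-Reasoning)
open import Data.Nat.Tactic.RingSolver using (solve-∀)
open import Data.Bool using (true; false)
open import Data.Maybe using (Maybe; just; nothing)
open import Data.Fin using (Fin; zero; suc; _≟_; toℕ; fromℕ; inject₁; combine)
open import Data.Fin.Properties using (all?; any?; toℕ-inject₁; toℕ-fromℕ; *↔×; +↔⊎)
open import Data.Fin.Relation.Unary.Top using (view; ‵fromℕ; ‵inject₁; view-fromℕ; view-inject₁)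
open import Data.Fin.Permutation using (permutation; _⟨$⟩ʳ_)
open import Data.Fin.Subset using (Subset; _∈_; ∣_∣; inside; outside)
open import Data.Fin.Subset.Properties using (_∈?_; anySubset?)
open import Data.Vec using (Vec; []; _∷_; _++_; concat; replicate; lookup; group)
open import Data.Vec.Properties using (lookup-concat; lookup-replicate; []=⇒lookup; lookup⇒[]=)
open import Data.Product using (Σ; ∃; ∃-syntax; _×_; _,_; proj₁; proj₂)
open import Data.Product.Properties using (≡-dec)
open import Data.Product.Function.NonDependent.Propositional using (_×-↔_)
open import Data.Sum using (_⊎_; inj₁; inj₂)
open import Data.Sum.Function.Propositional using (_⊎-↔_)
open import Data.Empty using (⊥-elim)
open import Function using (_∘_)
open import Function.Bundles using (_↔_; Inverse)
open import Function.Properties.Inverse using (↔-refl; ↔-sym; ↔-trans)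
open import Relation.Nullary using (¬?; Dec; yes; no)
open import Relation.Nullary.Decidable using (from-yes; from-no; map′; _×-dec_; _→-dec_; _⊎-dec_)
open import Relation.Binary.PropositionalEquality

private
  variable
    A : Set

-- Iteration and orbits

iter-+ : (g : A → A) → ∀ m n x → iter g (m + n) x ≡ iter g m (iter g n x)
iter-+ g zero    n x = refl
iter-+ g (suc m) n x = cong g (iter-+ g m n x)

iter-suc : (g : A → A) → ∀ n x → iter g (suc n) x ≡ iter g n (g x)
iter-suc g zero    x = refl
iter-suc g (suc n) x = cong g (iter-suc g n x)

iter-fixed : (g : A → A) → ∀ {x} → g x ≡ x → ∀ n → iter g n x ≡ x
iter-fixed g gx≡x zero    = refl
iter-fixed g gx≡x (suc n) = trans (cong g (iter-fixed g gx≡x n)) gx≡x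

module _ {A : Set} (g : A → A) (m : ℕ) where

  iter-chain : ∀ {k} (x : Fin (suc k) → A) → (∀ e → iter g m (x (inject₁ e)) ≡ x (suc e)) →
               ∀ i → iter g (m * toℕ i) (x zero) ≡ x i
  iter-chain x next zero = cong (λ t → iter g t (x zero)) (*-zeroʳ m)
  iter-chain {suc k} x next (suc i) = begin
    iter g (m * suc (toℕ i)) (x zero)      ≡⟨ cong (λ t → iter g t (x zero)) (trans (*-suc m (toℕ i)) (+-comm m _)) ⟩
    iter g (m * toℕ i + m) (x zero)        ≡⟨ iter-+ g (m * toℕ i) m (x zero) ⟩
    iter g (m * toℕ i) (iter g m (x zero)) ≡⟨ cong (iter g (m * toℕ i)) (next zero) ⟩
    iter g (m * toℕ i) (x (suc zero))      ≡⟨ iter-chain (x ∘ suc) (next ∘ suc) i ⟩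
    x (suc i)                              ∎
    where open ≡-Reasoning

  iter-chain-down : ∀ {k} (x : Fin (suc k) → A) → (∀ e → iter g m (x (suc e)) ≡ x (inject₁ e)) →
                    ∀ i → iter g (m * (k ∸ toℕ i)) (x (fromℕ k)) ≡ x i
  iter-chain-down {zero}  x next zero    = cong (λ t → iter g t (x zero)) (*-zeroʳ m)
  iter-chain-down {suc k} x next (suc i) = iter-chain-down (x ∘ suc) (next ∘ suc) i
  iter-chain-down {suc k} x next zero    = begin
    iter g (m * suc k) (x (fromℕ (suc k)))        ≡⟨ cong (λ t → iter g t (x (fromℕ (suc k)))) (*-suc m k) ⟩
    iter g (m + m * k) (x (fromℕ (suc k)))        ≡⟨ iter-+ g m (m * k) _ ⟩
    iter g m (iter g (m * k) (x (fromℕ (suc k)))) ≡⟨ cong (iter g m) (iter-chain-down (x ∘ suc) (next ∘ suc) zero) ⟩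
    iter g m (x (suc zero))                       ≡⟨ next zero ⟩
    x zero                                        ∎
    where open ≡-Reasoning

InOrbit : (A → A) → A → A → Set
InOrbit g x y = ∃[ k ] iter g k x ≡ y

record OrbitPresentation {D C : Set} (g : D → D) (cls : D → C) : Set where
  field
    cls-g     : ∀ x → cls (g x) ≡ cls x
    base      : C → D
    cls-base  : ∀ c → cls (base c) ≡ c
    index     : D → ℕ
    reach     : ∀ x → iter g (index x) (base (cls x)) ≡ x
    lastIndex : C → ℕ
    closes    : ∀ c → iter g (suc (lastIndex c)) (base c) ≡ base c

  cls-iter : ∀ k x → cls (iter g k x) ≡ cls x
  cls-iter zero    x = refl
  cls-iter (suc k) x = trans (cls-g _) (cls-iter k x)

  inOrbit⇒sameCls : ∀ {x y} → InOrbit g x y → cls x ≡ cls y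
  inOrbit⇒sameCls {x} (k , gᵏx≡y) = trans (sym (cls-iter k x)) (cong cls gᵏx≡y)

  iter-period : ∀ x → iter g (suc (lastIndex (cls x))) x ≡ x
  iter-period x = begin
    iter g p x                    ≡⟨ cong (iter g p) (sym (reach x)) ⟩
    iter g p (iter g (index x) b) ≡⟨ sym (iter-+ g p (index x) b) ⟩
    iter g (p + index x) b        ≡⟨ cong (λ m → iter g m b) (+-comm p (index x)) ⟩
    iter g (index x + p) b        ≡⟨ iter-+ g (index x) p b ⟩
    iter g (index x) (iter g p b) ≡⟨ cong (iter g (index x)) (closes (cls x)) ⟩
    iter g (index x) b            ≡⟨ reach x ⟩
    x                             ∎
    where
    open ≡-Reasoning
    p = suc (lastIndex (cls x))
    b = base (cls x)

  closes-* : ∀ c a → iter g (a * suc (lastIndex c)) (base c) ≡ base c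
  closes-* c zero    = refl
  closes-* c (suc a) = begin
    iter g (suc l + a * suc l) b          ≡⟨ iter-+ g (suc l) (a * suc l) b ⟩
    iter g (suc l) (iter g (a * suc l) b) ≡⟨ cong (iter g (suc l)) (closes-* c a) ⟩
    iter g (suc l) b                      ≡⟨ closes c ⟩
    b                                     ∎
    where
    open ≡-Reasoning
    l = lastIndex c
    b = base c

  toBase : ∀ x → iter g (index x * lastIndex (cls x)) x ≡ base (cls x)
  toBase x = begin
    iter g (m * l) x            ≡⟨ cong (iter g (m * l)) (sym (reach x)) ⟩
    iter g (m * l) (iter g m b) ≡⟨ sym (iter-+ g (m * l) m b) ⟩
    iter g (m * l + m) b        ≡⟨ cong (λ t → iter g t b) (trans (+-comm (m * l) m) (sym (*-suc m l))) ⟩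
    iter g (m * suc l) b        ≡⟨ closes-* (cls x) m ⟩
    b                           ∎
    where
    open ≡-Reasoning
    m = index x
    l = lastIndex (cls x)
    b = base (cls x)

  sameCls⇒inOrbit : ∀ {x y} → cls x ≡ cls y → InOrbit g x y
  sameCls⇒inOrbit {x} {y} eq = index y + index x * lastIndex (cls x) , (begin
    iter g (index y + index x * lastIndex (cls x)) x          ≡⟨ iter-+ g (index y) _ x ⟩
    iter g (index y) (iter g (index x * lastIndex (cls x)) x) ≡⟨ cong (iter g (index y)) (toBase x) ⟩
    iter g (index y) (base (cls x))                           ≡⟨ cong (iter g (index y) ∘ base) eq ⟩
    iter g (index y) (base (cls y))                           ≡⟨ reach y ⟩
    y                                                         ∎)
    where open ≡-Reasoning

  inverse : D → D
  inverse x = iter g (lastIndex (cls x)) x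

  g-inverse : ∀ x → g (inverse x) ≡ x
  g-inverse x = iter-period x

  inverse-g : ∀ x → inverse (g x) ≡ x
  inverse-g x = begin
    iter g (lastIndex (cls (g x))) (g x) ≡⟨ cong (λ c → iter g (lastIndex c) (g x)) (cls-g x) ⟩
    iter g (lastIndex (cls x)) (g x)     ≡⟨ sym (iter-suc g (lastIndex (cls x)) x) ⟩
    iter g (suc (lastIndex (cls x))) x   ≡⟨ iter-period x ⟩
    x                                    ∎
    where open ≡-Reasoning

-- Walks, 2-connectivity and triangular faces

module _ {G : PlaneGraph} where

  Adj-sym : ∀ {u v} → Adj G u v → Adj G v u
  Adj-sym (x , xᵤ , xᵥ) = α G x , xᵥ , trans (cong (vert G) (α-invol G x)) xᵤ

  module _ {P : Fin (n G) → Set} where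

    _++ʷ_ : ∀ {u v w} → Walk G P u v → Walk G P v w → Walk G P u w
    here _        ++ʷ q = q
    step pu e p   ++ʷ q = step pu e (p ++ʷ q)

    start : ∀ {u v} → Walk G P u v → P u
    start (here pu)     = pu
    start (step pu _ _) = pu

    finish : ∀ {u v} → Walk G P u v → P v
    finish (here pu)     = pu
    finish (step _ _ p)  = finish p

    reverseʷ : ∀ {u v} → Walk G P u v → Walk G P v u
    reverseʷ (here pu)     = here pu
    reverseʷ (step pu e p) = reverseʷ p ++ʷ step (start p) (Adj-sym e) (here pu)

record LowerNeighbours (G : PlaneGraph) (rank : Fin (n G) → ℕ) (u : Fin (n G)) : Set where
  field
    a b   : Fin (n G)
    a≢b   : a ≢ b
    u~a   : Adj G u a
    u~b   : Adj G u b
    a<u   : rank a < rank u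
    b<u   : rank b < rank u

module _ (G : PlaneGraph) (rank : Fin (n G) → ℕ) (r₀ r₁ : Fin (n G)) (r₀~r₁ : Adj G r₀ r₁)
         (lower : ∀ u → u ≢ r₀ → u ≢ r₁ → LowerNeighbours G rank u) where

  private
    Avoiding : Fin (n G) → Fin (n G) → Fin (n G) → Set
    Avoiding w = Walk G (_≢ w)

    IsRoot : Fin (n G) → Set
    IsRoot r = r ≡ r₀ ⊎ r ≡ r₁

    record Descent (w u : Fin (n G)) : Set where
      constructor descent
      field
        {root} : Fin (n G)
        isRoot : IsRoot root
        path   : Avoiding w u root

    extend : ∀ {w u c} → u ≢ w → Adj G u c → Descent w c → Descent w u
    extend u≢w u~c (descent isRoot path) = descent isRoot (step u≢w u~c path)

    lowerAvoiding : ∀ {u} w → LowerNeighbours G rank u → ∃[ c ] (c ≢ w × Adj G u c × rank c < rank u)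
    lowerAvoiding w L = choose (a ≟ w)
      where
      open LowerNeighbours L
      choose : Dec (a ≡ w) → ∃[ c ] (c ≢ w × Adj G _ c × rank c < rank _)
      choose (no a≢w)  = a , a≢w , u~a , a<u
      choose (yes a≡w) = b , (λ b≡w → a≢b (trans a≡w (sym b≡w))) , u~b , b<u

    descend : ∀ w fuel u → rank u < fuel → u ≢ w → Descent w u
    descend w (suc fuel) u rank<fuel u≢w with u ≟ r₀ | u ≟ r₁
    ... | yes refl | _    = descent (inj₁ refl) (here u≢w)
    ... | no _ | yes refl = descent (inj₂ refl) (here u≢w)
    ... | no u≢r₀ | no u≢r₁ with lowerAvoiding w (lower u u≢r₀ u≢r₁)
    ...   | c , c≢w , u~c , c<u = extend u≢w u~c (descend w fuel c (<-≤-trans c<u (s≤s⁻¹ rank<fuel)) c≢w)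

    descendFrom : ∀ w u → u ≢ w → Descent w u
    descendFrom w u = descend w (suc (rank u)) u (n<1+n (rank u))

    joinRoots : ∀ {w r r′} → IsRoot r → IsRoot r′ → r ≢ w → r′ ≢ w → Avoiding w r r′
    joinRoots (inj₁ refl) (inj₁ refl) r≢w _    = here r≢w
    joinRoots (inj₂ refl) (inj₂ refl) r≢w _    = here r≢w
    joinRoots (inj₁ refl) (inj₂ refl) r≢w r′≢w = step r≢w r₀~r₁ (here r′≢w)
    joinRoots (inj₂ refl) (inj₁ refl) r≢w r′≢w = step r≢w (Adj-sym {G} r₀~r₁) (here r′≢w)

  twoConnected-byRank : 3 ≤ n G → TwoConnected G
  twoConnected-byRank 3≤n = 3≤n , connect
    where
    connect : ∀ w u v → u ≢ w → v ≢ w → Avoiding w u v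
    connect w u v u≢w v≢w with descendFrom w u u≢w | descendFrom w v v≢w
    ... | descent ru pu | descent rv pv = pu ++ʷ (joinRoots ru rv (finish pu) (finish pv) ++ʷ reverseʷ pv)

module _ (G : PlaneGraph) where

  vert-σ : ∀ x → vert G (σ G ⟨$⟩ʳ x) ≡ vert G x
  vert-σ x = sym (orbit-vert G x _ (1 , refl))

  vert-φ : ∀ x → vert G (φ G x) ≡ vert G (α G x)
  vert-φ x = vert-σ (α G x)

  σ-fixed⇒unique : ∀ {z} → σ G ⟨$⟩ʳ z ≡ z → ∀ y → vert G y ≡ vert G z → y ≡ z
  σ-fixed⇒unique σz≡z y vy≡vz with vert-orbit G _ _ (sym vy≡vz)
  ... | k , σᵏz≡y = trans (sym σᵏz≡y) (iter-fixed (σ G ⟨$⟩ʳ_) σz≡z k)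

  φ²≢id : MinDegree≥3 G → ∀ x → φ G (φ G x) ≢ x
  φ²≢id minDeg x φ²x≡x with minDeg (vert G (α G x))
  ... | a , b , _ , u~a , u~b , _ , a≢b , _ = a≢b (trans (sym (endpoint u~a)) (endpoint u~b))
    where
    z = α G x
    -- The face x, φ x would be bounded by two parallel edges, so φ x = α x is fixed by σ.
    σz≡z : σ G ⟨$⟩ʳ z ≡ z
    σz≡z = no-multi G (φ G x) z (vert-φ x)
      (trans (sym (vert-φ (φ G x))) (trans (cong (vert G) φ²x≡x) (sym (cong (vert G) (α-invol G x)))))
    endpoint : ∀ {c} → Adj G (vert G z) c → vert G (α G z) ≡ c
    endpoint (w , w∈z , w→c) = subst (λ t → vert G (α G t) ≡ _) (σ-fixed⇒unique σz≡z w w∈z) w→c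

  triangularFace : MinDegree≥3 G → ∀ x → φ G (φ G (φ G x)) ≡ x → TriangularFaceAt G x
  triangularFace minDeg x φ³x≡x = φ≢id , φ²≢id minDeg x , φ³x≡x
    where
    φ≢id : φ G x ≢ x
    φ≢id φx≡x = loopless G x (trans (sym (vert-φ x)) (cong (vert G) φx≡x))

-- Plane graphs from combinatorial maps on finite types

infixr 2 _×ᶠ_
infixr 1 _⊎ᶠ_

_×ᶠ_ : ∀ {A B : Set} {m n} → A ↔ Fin m → B ↔ Fin n → (A × B) ↔ Fin (m * n)
e ×ᶠ e′ = ↔-trans (e ×-↔ e′) (↔-sym *↔×)

_⊎ᶠ_ : ∀ {A B : Set} {m n} → A ↔ Fin m → B ↔ Fin n → (A ⊎ B) ↔ Fin (m + n)
e ⊎ᶠ e′ = ↔-trans (e ⊎-↔ e′) (↔-sym +↔⊎)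

record FinitePlaneMap : Set₁ where
  field
    Dart Vertex Face       : Set
    #darts #vertices #faces : ℕ
    dart↔Fin   : Dart ↔ Fin #darts
    vertex↔Fin : Vertex ↔ Fin #vertices
    face↔Fin   : Face ↔ Fin #faces
    opposite rotation : Dart → Dart
    vertexOf : Dart → Vertex
    faceOf   : Dart → Face
    opposite-involutive : ∀ x → opposite (opposite x) ≡ x
    opposite-fixedPointFree : ∀ x → opposite x ≢ x
    vertexOrbits : OrbitPresentation rotation vertexOf
    faceOrbits   : OrbitPresentation (rotation ∘ opposite) faceOf
    no-loops : ∀ x → vertexOf (opposite x) ≢ vertexOf x
    no-parallelEdges : ∀ x y → vertexOf x ≡ vertexOf y → vertexOf (opposite x) ≡ vertexOf (opposite y) → x ≡ y
    eulerFormula : 2 * #vertices + 2 * #faces ≡ #darts + 4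

module Conjugation {A B : Set} (e : A ↔ B) where
  open Inverse e public using (to; from) renaming (strictlyInverseˡ to to-from; strictlyInverseʳ to from-to)

  to-injective : ∀ {x y} → to x ≡ to y → x ≡ y
  to-injective {x} {y} eq = trans (sym (from-to x)) (trans (cong from eq) (from-to y))

  from-injective : ∀ {x y} → from x ≡ from y → x ≡ y
  from-injective {x} {y} eq = trans (sym (to-from x)) (trans (cong to eq) (to-from y))

  conj : (A → A) → B → B
  conj g = to ∘ g ∘ from

  conj-to : ∀ g x → conj g (to x) ≡ to (g x)
  conj-to g x = cong (to ∘ g) (from-to x)

  conj-inverse : ∀ g h → (∀ x → g (h x) ≡ x) → ∀ y → conj g (conj h y) ≡ y
  conj-inverse g h gh≡id y = trans (conj-to g (h (from y))) (trans (cong to (gh≡id (from y))) (to-from y))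

  module _ (g : A → A) (h : B → B) (h-to : ∀ x → h (to x) ≡ to (g x)) where

    iter-to : ∀ k x → iter h k (to x) ≡ to (iter g k x)
    iter-to zero    x = refl
    iter-to (suc k) x = trans (cong h (iter-to k x)) (h-to (iter g k x))

    inOrbit-from⇒inOrbit : ∀ {x y} → InOrbit g (from x) (from y) → InOrbit h x y
    inOrbit-from⇒inOrbit {x} {y} (k , eq) = k , (begin
      iter h k x             ≡⟨ cong (iter h k) (sym (to-from x)) ⟩
      iter h k (to (from x)) ≡⟨ iter-to k (from x) ⟩
      to (iter g k (from x)) ≡⟨ cong to eq ⟩
      to (from y)            ≡⟨ to-from y ⟩
      y                      ∎)
      where open ≡-Reasoning

    inOrbit⇒inOrbit-from : ∀ {x y} → InOrbit h x y → InOrbit g (from x) (from y)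
    inOrbit⇒inOrbit-from {x} {y} (k , eq) = k , to-injective (begin
      to (iter g k (from x)) ≡⟨ sym (iter-to k (from x)) ⟩
      iter h k (to (from x)) ≡⟨ cong (iter h k) (to-from x) ⟩
      iter h k x             ≡⟨ eq ⟩
      y                      ≡⟨ sym (to-from y) ⟩
      to (from y)            ∎)
      where open ≡-Reasoning

module PlaneGraphOf (M : FinitePlaneMap) where
  open FinitePlaneMap M
  module Darts    = Conjugation dart↔Fin
  module Vertices = Conjugation vertex↔Fin
  module Faces    = Conjugation face↔Fin
  open Darts using (conj; conj-to)

  φ-to : ∀ x → conj rotation (conj opposite (Darts.to x)) ≡ Darts.to (rotation (opposite x))
  φ-to x = trans (cong (conj rotation) (conj-to opposite x)) (conj-to rotation (opposite x))

  module Orbits {C : Set} {m} (C↔Fin : C ↔ Fin m) {g : Dart → Dart} {cls : Dart → C} (O : OrbitPresentation g cls)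
                (h : Fin #darts → Fin #darts) (h-to : ∀ x → h (Darts.to x) ≡ Darts.to (g x)) where
    module Cls = Conjugation C↔Fin
    module O = OrbitPresentation O

    clsᴳ : Fin #darts → Fin m
    clsᴳ x = Cls.to (cls (Darts.from x))

    clsᴳ-surjective : ∀ c → ∃[ x ] clsᴳ x ≡ c
    clsᴳ-surjective c = Darts.to (O.base (Cls.from c)) ,
      trans (cong (Cls.to ∘ cls) (Darts.from-to _)) (trans (cong Cls.to (O.cls-base _)) (Cls.to-from c))

    sameClsᴳ⇒inOrbit : ∀ x y → clsᴳ x ≡ clsᴳ y → InOrbit h x y
    sameClsᴳ⇒inOrbit x y eq = Darts.inOrbit-from⇒inOrbit g h h-to (O.sameCls⇒inOrbit (Cls.to-injective eq))

    inOrbit⇒sameClsᴳ : ∀ x y → InOrbit h x y → clsᴳ x ≡ clsᴳ y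
    inOrbit⇒sameClsᴳ x y o = cong Cls.to (O.inOrbit⇒sameCls (Darts.inOrbit⇒inOrbit-from g h h-to o))

  module VertexOrbits = Orbits vertex↔Fin vertexOrbits (conj rotation) (conj-to rotation)
  module FaceOrbits   = Orbits face↔Fin faceOrbits (conj rotation ∘ conj opposite) φ-to
  module VO = OrbitPresentation vertexOrbits
  module FO = OrbitPresentation faceOrbits

  vertexᴳ : Fin #darts → Fin #vertices
  vertexᴳ = VertexOrbits.clsᴳ

  vertexᴳ-opposite : ∀ x → vertexᴳ (conj opposite x) ≡ Vertices.to (vertexOf (opposite (Darts.from x)))
  vertexᴳ-opposite x = cong (Vertices.to ∘ vertexOf) (Darts.from-to _)

  G : PlaneGraph
  G = record
    { n = #vertices ; d = #darts ; f = #faces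
    ; α = conj opposite
    ; σ = permutation (conj rotation) (conj VO.inverse)
            (Darts.conj-inverse rotation VO.inverse VO.g-inverse) (Darts.conj-inverse VO.inverse rotation VO.inverse-g)
    ; vert = vertexᴳ
    ; face = FaceOrbits.clsᴳ
    ; α-invol = Darts.conj-inverse opposite opposite opposite-involutive
    ; α-fpf = λ x eq → opposite-fixedPointFree (Darts.from x) (trans (sym (Darts.from-to _)) (cong Darts.from eq))
    ; vert-surj = VertexOrbits.clsᴳ-surjective
    ; vert-orbit = VertexOrbits.sameClsᴳ⇒inOrbit
    ; orbit-vert = VertexOrbits.inOrbit⇒sameClsᴳ
    ; face-surj = FaceOrbits.clsᴳ-surjective
    ; face-orbit = FaceOrbits.sameClsᴳ⇒inOrbit
    ; orbit-face = FaceOrbits.inOrbit⇒sameClsᴳ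
    ; loopless = λ x eq → no-loops (Darts.from x) (Vertices.to-injective (trans (sym (vertexᴳ-opposite x)) eq))
    ; no-multi = λ x y same₁ same₂ → Darts.from-injective (no-parallelEdges _ _ (Vertices.to-injective same₁)
        (Vertices.to-injective (trans (sym (vertexᴳ-opposite x)) (trans same₂ (vertexᴳ-opposite y)))))
    ; euler = eulerFormula
    }

  adj : ∀ x → Adj G (Vertices.to (vertexOf x)) (Vertices.to (vertexOf (opposite x)))
  adj x = Darts.to x , cong (Vertices.to ∘ vertexOf) (Darts.from-to x) ,
          trans (vertexᴳ-opposite (Darts.to x)) (cong (Vertices.to ∘ vertexOf ∘ opposite) (Darts.from-to x))

  adj⁻ : ∀ {u v} → Adj G u v → Σ Dart λ x → Vertices.to (vertexOf x) ≡ u × Vertices.to (vertexOf (opposite x)) ≡ v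
  adj⁻ (y , yᵤ , yᵥ) = Darts.from y , yᵤ , trans (sym (vertexᴳ-opposite y)) yᵥ

  triangleOrbit : ∀ x → FO.lastIndex (faceOf (Darts.from x)) ≡ 2 → φ G (φ G (φ G x)) ≡ x
  triangleOrbit x length≡2 = begin
    iter (φ G) 3 x                            ≡⟨ cong (iter (φ G) 3) (sym (Darts.to-from x)) ⟩
    iter (φ G) 3 (Darts.to y)                 ≡⟨ Darts.iter-to (rotation ∘ opposite) (φ G) φ-to 3 y ⟩
    Darts.to (iter (rotation ∘ opposite) 3 y) ≡⟨ cong (λ l → Darts.to (iter (rotation ∘ opposite) (suc l) y)) (sym length≡2) ⟩
    Darts.to (iter (rotation ∘ opposite) (suc (FO.lastIndex (faceOf y))) y) ≡⟨ cong Darts.to (FO.iter-period y) ⟩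
    Darts.to y                                ≡⟨ Darts.to-from x ⟩
    x                                         ∎
    where
    open ≡-Reasoning
    y = Darts.from x

  adj-at : ∀ {v} x → vertexOf x ≡ Vertices.from v → Adj G v (Vertices.to (vertexOf (opposite x)))
  adj-at {v} x x∈v = subst (λ u → Adj G u _) (trans (cong Vertices.to x∈v) (Vertices.to-from v)) (adj x)

  far : Dart → Vertex
  far x = vertexOf (opposite x)

  record ThreeNeighbours (v : Vertex) : Set where
    field
      x₁ x₂ x₃ : Dart
      x₁∈v : vertexOf x₁ ≡ v
      x₂∈v : vertexOf x₂ ≡ v
      x₃∈v : vertexOf x₃ ≡ v
      far₁≢far₂ : far x₁ ≢ far x₂
      far₁≢far₃ : far x₁ ≢ far x₃
      far₂≢far₃ : far x₂ ≢ far x₃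

  minDegree≥3 : (∀ v → ThreeNeighbours v) → MinDegree≥3 G
  minDegree≥3 three v = Vertices.to (far x₁) , Vertices.to (far x₂) , Vertices.to (far x₃) ,
    adj-at x₁ x₁∈v , adj-at x₂ x₂∈v , adj-at x₃ x₃∈v ,
    far₁≢far₂ ∘ Vertices.to-injective , far₁≢far₃ ∘ Vertices.to-injective , far₂≢far₃ ∘ Vertices.to-injective
    where open ThreeNeighbours (three (Vertices.from v))

  record TwoLowerNeighbours (rank : Vertex → ℕ) (v : Vertex) : Set where
    field
      x y     : Dart
      x∈v     : vertexOf x ≡ v
      y∈v     : vertexOf y ≡ v
      far≢far : far x ≢ far y
      x<v     : rank (far x) < rank v
      y<v     : rank (far y) < rank v

  twoConnected : 3 ≤ #vertices → (rank : Vertex → ℕ) (x₀ : Dart) →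
    (∀ v → v ≢ vertexOf x₀ → v ≢ far x₀ → TwoLowerNeighbours rank v) → TwoConnected G
  twoConnected 3≤n rank x₀ lower = twoConnected-byRank G (rank ∘ Vertices.from) _ _ (adj x₀) lowerᴳ 3≤n
    where
    rank-to : ∀ v → rank (Vertices.from (Vertices.to v)) ≡ rank v
    rank-to v = cong rank (Vertices.from-to v)
    avoid : ∀ {u w} → u ≢ Vertices.to w → Vertices.from u ≢ w
    avoid {u} u≢w eq = u≢w (trans (sym (Vertices.to-from u)) (cong Vertices.to eq))
    lowerᴳ : ∀ u → u ≢ Vertices.to (vertexOf x₀) → u ≢ Vertices.to (far x₀) → LowerNeighbours G (rank ∘ Vertices.from) u
    lowerᴳ u u≢r₀ u≢r₁ = record
      { a = Vertices.to (far x) ; b = Vertices.to (far y) ; a≢b = far≢far ∘ Vertices.to-injective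
      ; u~a = adj-at x x∈v ; u~b = adj-at y y∈v
      ; a<u = subst (_< rank (Vertices.from u)) (sym (rank-to (far x))) x<v
      ; b<u = subst (_< rank (Vertices.from u)) (sym (rank-to (far y))) y<v }
      where open TwoLowerNeighbours (lower (Vertices.from u) (avoid u≢r₀) (avoid u≢r₁))

  DominatedBy : Subset #vertices → Vertex → Set
  DominatedBy S v = Vertices.to v ∈ S ⊎ ∃[ x ] (far x ≡ v × Vertices.to (vertexOf x) ∈ S)

  dominating : ∀ S → (∀ v → DominatedBy S v) → Dominating G S
  dominating S dominated u with dominated (Vertices.from u)
  ... | inj₁ u∈S = inj₁ (subst (_∈ S) (Vertices.to-from u) u∈S)
  ... | inj₂ (x , x→u , x∈S) =
    inj₂ (Vertices.to (vertexOf x) , x∈S , subst (Adj G _) (trans (cong Vertices.to x→u) (Vertices.to-from u)) (adj x))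

  dominated : ∀ S → Dominating G S → ∀ v → DominatedBy S v
  dominated S dom v with dom (Vertices.to v)
  ... | inj₁ v∈S = inj₁ v∈S
  ... | inj₂ (u , u∈S , u~v) with adj⁻ u~v
  ...   | x , x∈u , x→v = inj₂ (x , Vertices.to-injective x→v , subst (_∈ S) (sym x∈u) u∈S)

-- Counting subsets

∣++∣ : ∀ {m n} (p : Subset m) (q : Subset n) → ∣ p ++ q ∣ ≡ ∣ p ∣ + ∣ q ∣
∣++∣ []          q = refl
∣++∣ (true ∷ p)  q = cong suc (∣++∣ p q)
∣++∣ (false ∷ p) q = ∣++∣ p q

∣concat-replicate∣ : ∀ m {n} (p : Subset n) → ∣ concat (replicate m p) ∣ ≡ m * ∣ p ∣
∣concat-replicate∣ zero    p = refl
∣concat-replicate∣ (suc m) p = trans (∣++∣ p _) (cong (∣ p ∣ +_) (∣concat-replicate∣ m p))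

∈-concat-replicate : ∀ {m n} {p : Subset n} (i : Fin m) {j} → j ∈ p → combine i j ∈ concat (replicate m p)
∈-concat-replicate {m} {p = p} i {j} j∈p = lookup⇒[]= _ _ (begin
  lookup (concat (replicate m p)) (combine i j) ≡⟨ lookup-concat (replicate m p) i j ⟩
  lookup (lookup (replicate m p) i) j           ≡⟨ cong (λ q → lookup q j) (lookup-replicate i p) ⟩
  lookup p j                                    ≡⟨ []=⇒lookup j∈p ⟩
  true                                          ∎)
  where open ≡-Reasoning

∣concat∣-lowerBound : ∀ {m n c} (pss : Vec (Subset n) m) → (∀ i → c ≤ ∣ lookup pss i ∣) → m * c ≤ ∣ concat pss ∣
∣concat∣-lowerBound []         _     = z≤n
∣concat∣-lowerBound (ps ∷ pss) bound =
  subst (_ ≤_) (sym (∣++∣ ps (concat pss))) (+-mono-≤ (bound zero) (∣concat∣-lowerBound pss (bound ∘ suc)))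

module Blocks (m n : ℕ) (S : Subset (m * n)) where

  blocks : Vec (Subset n) m
  blocks = proj₁ (group m n S)

  ∈-block : ∀ i {j} → combine i j ∈ S → j ∈ lookup blocks i
  ∈-block i {j} ij∈S = lookup⇒[]= j _ (begin
    lookup (lookup blocks i) j           ≡⟨ sym (lookup-concat blocks i j) ⟩
    lookup (concat blocks) (combine i j) ≡⟨ cong (λ q → lookup q (combine i j)) (sym (proj₂ (group m n S))) ⟩
    lookup S (combine i j)               ≡⟨ []=⇒lookup ij∈S ⟩
    true                                 ∎)
    where open ≡-Reasoning

  ∣S∣-lowerBound : ∀ {c} → (∀ i → c ≤ ∣ lookup blocks i ∣) → m * c ≤ ∣ S ∣
  ∣S∣-lowerBound bound = subst (λ q → _ ≤ ∣ q ∣) (sym (proj₂ (group m n S))) (∣concat∣-lowerBound blocks bound)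

-- The gadget H

-- Vertex 0 of H is joined to the path 1 2 3 4 5 6 7, vertex 9 to 1, 2, 3, vertex 8 to 5, 6, 7,
-- and 3 to 5. The dart dXY runs from X to Y.
pattern v0 = zero
pattern v1 = suc v0
pattern v2 = suc v1
pattern v3 = suc v2
pattern v4 = suc v3
pattern v5 = suc v4
pattern v6 = suc v5
pattern v7 = suc v6
pattern v8 = suc v7
pattern v9 = suc v8

pattern e01 = zero
pattern e02 = suc e01
pattern e03 = suc e02
pattern e04 = suc e03
pattern e05 = suc e04
pattern e06 = suc e05
pattern e07 = suc e06
pattern e12 = suc e07
pattern e23 = suc e12
pattern e34 = suc e23
pattern e45 = suc e34
pattern e56 = suc e45
pattern e67 = suc e56
pattern e19 = suc e67
pattern e29 = suc e19
pattern e39 = suc e29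
pattern e35 = suc e39
pattern e58 = suc e35
pattern e68 = suc e58
pattern e78 = suc e68

GVertex GEdge : Set
GVertex = Fin 10
GEdge   = Fin 20

endpoints : GEdge → GVertex × GVertex
endpoints e01 = v0 , v1
endpoints e02 = v0 , v2
endpoints e03 = v0 , v3
endpoints e04 = v0 , v4
endpoints e05 = v0 , v5
endpoints e06 = v0 , v6
endpoints e07 = v0 , v7
endpoints e12 = v1 , v2
endpoints e23 = v2 , v3
endpoints e34 = v3 , v4
endpoints e45 = v4 , v5
endpoints e56 = v5 , v6
endpoints e67 = v6 , v7
endpoints e19 = v1 , v9
endpoints e29 = v2 , v9
endpoints e39 = v3 , v9
endpoints e35 = v3 , v5
endpoints e58 = v5 , v8
endpoints e68 = v6 , v8
endpoints e78 = v7 , v8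

pattern fwd = zero
pattern bwd = suc zero

GDart : Set
GDart = GEdge × Fin 2

source : GDart → GVertex
source (e , fwd) = proj₁ (endpoints e)
source (e , bwd) = proj₂ (endpoints e)

reverse : GDart → GDart
reverse (e , fwd) = e , bwd
reverse (e , bwd) = e , fwd

target : GDart → GVertex
target d = source (reverse d)

pattern d01 = e01 , fwd
pattern d10 = e01 , bwd
pattern d02 = e02 , fwd
pattern d20 = e02 , bwd
pattern d03 = e03 , fwd
pattern d30 = e03 , bwd
pattern d04 = e04 , fwd
pattern d40 = e04 , bwd
pattern d05 = e05 , fwd
pattern d50 = e05 , bwd
pattern d06 = e06 , fwd
pattern d60 = e06 , bwd
pattern d07 = e07 , fwd
pattern d70 = e07 , bwd
pattern d12 = e12 , fwd
pattern d21 = e12 , bwd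
pattern d23 = e23 , fwd
pattern d32 = e23 , bwd
pattern d34 = e34 , fwd
pattern d43 = e34 , bwd
pattern d45 = e45 , fwd
pattern d54 = e45 , bwd
pattern d56 = e56 , fwd
pattern d65 = e56 , bwd
pattern d67 = e67 , fwd
pattern d76 = e67 , bwd
pattern d19 = e19 , fwd
pattern d91 = e19 , bwd
pattern d29 = e29 , fwd
pattern d92 = e29 , bwd
pattern d39 = e39 , fwd
pattern d93 = e39 , bwd
pattern d35 = e35 , fwd
pattern d53 = e35 , bwd
pattern d58 = e58 , fwd
pattern d85 = e58 , bwd
pattern d68 = e68 , fwd
pattern d86 = e68 , bwd
pattern d78 = e78 , fwd
pattern d87 = e78 , bwd

-- The rotation of H in its own plane embedding; the chain inserts its link and crossing darts
-- right after d39 and d53.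
turn : GDart → GDart
turn d01 = d02
turn d10 = d19
turn d02 = d03
turn d20 = d21
turn d03 = d04
turn d30 = d32
turn d04 = d05
turn d40 = d43
turn d05 = d06
turn d50 = d54
turn d06 = d07
turn d60 = d65
turn d07 = d01
turn d70 = d76
turn d12 = d10
turn d21 = d29
turn d23 = d20
turn d32 = d39
turn d34 = d30
turn d43 = d45
turn d45 = d40
turn d54 = d53
turn d56 = d50
turn d65 = d68
turn d67 = d60
turn d76 = d78
turn d19 = d12
turn d91 = d93
turn d29 = d23
turn d92 = d91
turn d39 = d35
turn d93 = d92
turn d35 = d34
turn d53 = d58
turn d58 = d56
turn d85 = d87
turn d68 = d67
turn d86 = d85
turn d78 = d70
turn d87 = d86

reverse-involutive : ∀ d → reverse (reverse d) ≡ d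
reverse-involutive (e , fwd) = refl
reverse-involutive (e , bwd) = refl

pattern t0 = zero
pattern t1 = suc t0
pattern t2 = suc t1
pattern t3 = suc t2
pattern t4 = suc t3
pattern t5 = suc t4
pattern t6 = suc t5
pattern t7 = suc t6
pattern t8 = suc t7
pattern t9 = suc t8
pattern t10 = suc t9

triangleOf : GDart → Maybe (Fin 11)
triangleOf d10 = just t0
triangleOf d02 = just t0
triangleOf d21 = just t0
triangleOf d20 = just t1
triangleOf d03 = just t1
triangleOf d32 = just t1
triangleOf d30 = just t2
triangleOf d04 = just t2
triangleOf d43 = just t2
triangleOf d40 = just t3
triangleOf d05 = just t3
triangleOf d54 = just t3
triangleOf d50 = just t4
triangleOf d06 = just t4
triangleOf d65 = just t4
triangleOf d60 = just t5
triangleOf d07 = just t5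
triangleOf d76 = just t5
triangleOf d12 = just t6
triangleOf d29 = just t6
triangleOf d91 = just t6
triangleOf d23 = just t7
triangleOf d39 = just t7
triangleOf d92 = just t7
triangleOf d34 = just t8
triangleOf d45 = just t8
triangleOf d53 = just t8
triangleOf d56 = just t9
triangleOf d68 = just t9
triangleOf d85 = just t9
triangleOf d67 = just t10
triangleOf d78 = just t10
triangleOf d86 = just t10
triangleOf d01 = nothing
triangleOf d19 = nothing
triangleOf d93 = nothing
triangleOf d35 = nothing
triangleOf d58 = nothing
triangleOf d87 = nothing
triangleOf d70 = nothing

triangleBase : Fin 11 → GDart
triangleBase t0 = d10
triangleBase t1 = d20
triangleBase t2 = d30
triangleBase t3 = d40
triangleBase t4 = d50
triangleBase t5 = d60
triangleBase t6 = d12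
triangleBase t7 = d23
triangleBase t8 = d34
triangleBase t9 = d56
triangleBase t10 = d67

-- Position of a dart in its face of H, counted from triangleBase, or from d58 along the outer face.
positionInFace : GDart → ℕ
positionInFace d10 = 0
positionInFace d02 = 1
positionInFace d21 = 2
positionInFace d20 = 0
positionInFace d03 = 1
positionInFace d32 = 2
positionInFace d30 = 0
positionInFace d04 = 1
positionInFace d43 = 2
positionInFace d40 = 0
positionInFace d05 = 1
positionInFace d54 = 2
positionInFace d50 = 0
positionInFace d06 = 1
positionInFace d65 = 2
positionInFace d60 = 0
positionInFace d07 = 1
positionInFace d76 = 2
positionInFace d12 = 0
positionInFace d29 = 1
positionInFace d91 = 2
positionInFace d23 = 0
positionInFace d39 = 1
positionInFace d92 = 2
positionInFace d34 = 0
positionInFace d45 = 1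
positionInFace d53 = 2
positionInFace d56 = 0
positionInFace d68 = 1
positionInFace d85 = 2
positionInFace d67 = 0
positionInFace d78 = 1
positionInFace d86 = 2
positionInFace d58 = 0
positionInFace d87 = 1
positionInFace d70 = 2
positionInFace d01 = 3
positionInFace d19 = 4
positionInFace d93 = 5
positionInFace d35 = 0

gadgetVertexBase : GVertex → GDart
gadgetVertexBase v0 = d02
gadgetVertexBase v1 = d19
gadgetVertexBase v2 = d29
gadgetVertexBase v3 = d35
gadgetVertexBase v4 = d43
gadgetVertexBase v5 = d58
gadgetVertexBase v6 = d65
gadgetVertexBase v7 = d76
gadgetVertexBase v8 = d85
gadgetVertexBase v9 = d93

positionAtVertex : GDart → ℕ
positionAtVertex d01 = 6
positionAtVertex d10 = 2
positionAtVertex d02 = 0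
positionAtVertex d20 = 2
positionAtVertex d03 = 1
positionAtVertex d30 = 2
positionAtVertex d04 = 2
positionAtVertex d40 = 2
positionAtVertex d05 = 3
positionAtVertex d50 = 2
positionAtVertex d06 = 4
positionAtVertex d60 = 3
positionAtVertex d07 = 5
positionAtVertex d70 = 2
positionAtVertex d12 = 1
positionAtVertex d21 = 3
positionAtVertex d23 = 1
positionAtVertex d32 = 3
positionAtVertex d34 = 1
positionAtVertex d43 = 0
positionAtVertex d45 = 1
positionAtVertex d54 = 3
positionAtVertex d56 = 1
positionAtVertex d65 = 0
positionAtVertex d67 = 2
positionAtVertex d76 = 0
positionAtVertex d19 = 0
positionAtVertex d91 = 2
positionAtVertex d29 = 0
positionAtVertex d92 = 1
positionAtVertex d39 = 4
positionAtVertex d93 = 0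
positionAtVertex d35 = 0
positionAtVertex d53 = 4
positionAtVertex d58 = 0
positionAtVertex d85 = 0
positionAtVertex d68 = 1
positionAtVertex d86 = 2
positionAtVertex d78 = 1
positionAtVertex d87 = 1

gadgetLastIndex : GVertex → ℕ
gadgetLastIndex v0 = 6
gadgetLastIndex v1 = 2
gadgetLastIndex v2 = 3
gadgetLastIndex v3 = 4
gadgetLastIndex v4 = 2
gadgetLastIndex v5 = 4
gadgetLastIndex v6 = 3
gadgetLastIndex v7 = 2
gadgetLastIndex v8 = 2
gadgetLastIndex v9 = 2

endpoints-distinct : ∀ e → proj₁ (endpoints e) ≢ proj₂ (endpoints e)
endpoints-distinct = from-yes (all? λ e → ¬? (proj₁ (endpoints e) ≟ proj₂ (endpoints e)))

anyDart? : {P : GDart → Set} → (∀ d → Dec (P d)) → Dec (∃ P)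
anyDart? P? = map′ (λ { (e , o , p) → (e , o) , p }) (λ { ((e , o) , p) → e , o , p }) (any? λ e → any? λ o → P? (e , o))

allDarts? : {P : GDart → Set} → (∀ d → Dec (P d)) → Dec (∀ d → P d)
allDarts? P? = map′ (λ all → λ { (e , o) → all e o }) (λ all e o → all (e , o)) (all? λ e → all? λ o → P? (e , o))

gadget-simple : ∀ d d′ → source d ≡ source d′ → target d ≡ target d′ → d ≡ d′
gadget-simple = from-yes (allDarts? λ d → allDarts? λ d′ →
  (source d ≟ source d′) →-dec (target d ≟ target d′) →-dec ≡-dec _≟_ _≟_ d d′)

dartBetween? : ∀ a b → Dec (∃[ d ] (source d ≡ a × target d ≡ b))
dartBetween? a b = anyDart? λ d → (source d ≟ a) ×-dec (target d ≟ b)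

dartBetween : GVertex → GVertex → GDart
dartBetween a b with dartBetween? a b
... | yes (d , _) = d
... | no _        = d01

dartBetween-correct : ∀ d → dartBetween (source d) (target d) ≡ d
dartBetween-correct d with dartBetween? (source d) (target d)
... | yes (d′ , src , tgt) = gadget-simple d′ d src tgt
... | no none              = ⊥-elim (none (d , refl , refl))

source-turn : ∀ d → source (turn d) ≡ source d
source-turn = from-yes (allDarts? λ d → source (turn d) ≟ source d)

source-vertexBase : ∀ j → source (gadgetVertexBase j) ≡ j
source-vertexBase = from-yes (all? λ j → source (gadgetVertexBase j) ≟ j)

firstNeighboursDistinct : ∀ j → let b = gadgetVertexBase j in
  target b ≢ target (turn b) × target b ≢ target (turn (turn b)) × target (turn b) ≢ target (turn (turn b))
firstNeighboursDistinct = from-yes (all? λ j → let b = gadgetVertexBase j in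
  ¬? (target b ≟ target (turn b)) ×-dec ¬? (target b ≟ target (turn (turn b))) ×-dec ¬? (target (turn b) ≟ target (turn (turn b))))

Internal : GVertex → Set
Internal j = j ≢ v3 × j ≢ v5

internalRank : GVertex → ℕ
internalRank v4 = 4
internalRank v0 = 5
internalRank v2 = 6
internalRank v9 = 7
internalRank v1 = 8
internalRank v6 = 9
internalRank v8 = 10
internalRank v7 = 11
internalRank _  = 0

lowerDarts : GVertex → GDart × GDart
lowerDarts v4 = d43 , d45
lowerDarts v0 = d03 , d05
lowerDarts v2 = d20 , d23
lowerDarts v9 = d92 , d93
lowerDarts v1 = d10 , d12
lowerDarts v6 = d60 , d65
lowerDarts v8 = d85 , d86
lowerDarts v7 = d70 , d76
lowerDarts _  = d01 , d01

GadgetDominated : Subset 10 → GVertex → Set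
GadgetDominated p j = j ∈ p ⊎ ∃[ d ] (source d ≡ j × target d ∈ p)

gadgetDominated? : ∀ p j → Dec (GadgetDominated p j)
gadgetDominated? p j = (j ∈? p) ⊎-dec anyDart? (λ d → (source d ≟ j) ×-dec (target d ∈? p))

gadgetDominators : Subset 10
gadgetDominators = inside ∷ outside ∷ inside ∷ outside ∷ outside ∷ outside ∷ inside ∷ outside ∷ outside ∷ outside ∷ []

gadgetDominators-dominate : ∀ j → GadgetDominated gadgetDominators j
gadgetDominators-dominate = from-yes (all? (gadgetDominated? gadgetDominators))

dominatesInternal⇒3≤∣p∣ : ∀ p → (∀ j → Internal j → GadgetDominated p j) → 3 ≤ ∣ p ∣
dominatesInternal⇒3≤∣p∣ p dominated = ≮⇒≥ (λ small → noSmallDominator (p , small , dominated))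
  where
  noSmallDominator = from-no (anySubset? λ p → (∣ p ∣ <? 3) ×-dec
    all? λ j → (¬? (j ≟ v3) ×-dec ¬? (j ≟ v5)) →-dec gadgetDominated? p j)

-- The chain of blocks

Side : Set
Side = Fin 2

pattern top = zero
pattern bot = suc zero

-- P and Q are the vertices 3 and 5 of the top copy of H, S and R those of the bottom copy.
-- The link dart XY runs from X to Y inside one block; in a crossing dart between blocks e and
-- e + 1, lower-case letters refer to block e and upper-case letters to block e + 1.
BlockDart : Set
BlockDart = (GDart × Side) ⊎ Fin 6

pattern gadget s d = inj₁ (d , s)
pattern PR = inj₂ zero
pattern RP = inj₂ (suc zero)
pattern RQ = inj₂ (suc (suc zero))
pattern QR = inj₂ (suc (suc (suc zero)))
pattern QS = inj₂ (suc (suc (suc (suc zero))))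
pattern SQ = inj₂ (suc (suc (suc (suc (suc zero)))))

CrossDart : Set
CrossDart = Fin 6

pattern qP = zero
pattern Pq = suc zero
pattern sP = suc (suc zero)
pattern Ps = suc (suc (suc zero))
pattern sR = suc (suc (suc (suc zero)))
pattern Rs = suc (suc (suc (suc (suc zero))))

Dart : ℕ → Set
Dart k = (Fin (suc k) × BlockDart) ⊎ (Fin k × CrossDart)

pattern inBlock i b = inj₁ (i , b)
pattern across e c = inj₂ (e , c)

Vertex : ℕ → Set
Vertex k = Fin (suc k) × Side × GVertex

BlockFace : Set
BlockFace = (Side × Fin 11) ⊎ Fin 2

Face : ℕ → Set
Face k = (Fin (suc k) × BlockFace) ⊎ ((Fin k × Fin 2) ⊎ Fin 1)

pattern gadgetTriangle i s t = inj₁ (i , inj₁ (s , t))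
pattern linkTriangle i t = inj₁ (i , inj₂ t)
pattern crossTriangle e t = inj₂ (inj₁ (e , t))
pattern outer = inj₂ (inj₂ zero)

inject₁≢suc : ∀ {k} (e : Fin k) → inject₁ e ≢ suc e
inject₁≢suc e eq = <⇒≢ (n<1+n (toℕ e)) (trans (sym (toℕ-inject₁ e)) (cong toℕ eq))

module _ {k : ℕ} where

  opposite : Dart k → Dart k
  opposite (inBlock i (gadget s d)) = inBlock i (gadget s (reverse d))
  opposite (inBlock i PR) = inBlock i RP
  opposite (inBlock i RP) = inBlock i PR
  opposite (inBlock i RQ) = inBlock i QR
  opposite (inBlock i QR) = inBlock i RQ
  opposite (inBlock i QS) = inBlock i SQ
  opposite (inBlock i SQ) = inBlock i QS
  opposite (across e qP) = across e Pq
  opposite (across e Pq) = across e qP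
  opposite (across e sP) = across e Ps
  opposite (across e Ps) = across e sP
  opposite (across e sR) = across e Rs
  opposite (across e Rs) = across e sR

  vertexOf : Dart k → Vertex k
  vertexOf (inBlock i (gadget s d)) = i , s , source d
  vertexOf (inBlock i PR) = i , top , v3
  vertexOf (inBlock i RP) = i , bot , v5
  vertexOf (inBlock i RQ) = i , bot , v5
  vertexOf (inBlock i QR) = i , top , v5
  vertexOf (inBlock i QS) = i , top , v5
  vertexOf (inBlock i SQ) = i , bot , v3
  vertexOf (across e qP) = inject₁ e , top , v5
  vertexOf (across e Pq) = suc e , top , v3
  vertexOf (across e sP) = inject₁ e , bot , v3
  vertexOf (across e Ps) = suc e , top , v3
  vertexOf (across e sR) = inject₁ e , bot , v3
  vertexOf (across e Rs) = suc e , bot , v5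

  -- The block dart comes first, so that ordinary gadget darts rotate without a split on the block.
  rotationInBlock : BlockDart → Fin (suc k) → Dart k
  rotationInBlock (gadget top d39) zero    = inBlock zero PR
  rotationInBlock (gadget top d39) (suc e) = across e Pq
  rotationInBlock (gadget bot d39) i with view i
  ... | ‵fromℕ     = inBlock (fromℕ k) SQ
  ... | ‵inject₁ e = across e sR
  rotationInBlock (gadget top d53) i = inBlock i QR
  rotationInBlock (gadget bot d53) i = inBlock i RQ
  rotationInBlock (gadget s d)     i = inBlock i (gadget s (turn d))
  rotationInBlock PR i = inBlock i (gadget top d35)
  rotationInBlock QR i = inBlock i QS
  rotationInBlock QS i with view i
  ... | ‵fromℕ     = inBlock (fromℕ k) (gadget top d58)
  ... | ‵inject₁ e = across e qP
  rotationInBlock SQ i = inBlock i (gadget bot d35)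
  rotationInBlock RQ i = inBlock i RP
  rotationInBlock RP zero    = inBlock zero (gadget bot d58)
  rotationInBlock RP (suc e) = across e Rs

  rotation : Dart k → Dart k
  rotation (inBlock i b) = rotationInBlock b i
  rotation (across e qP) = inBlock (inject₁ e) (gadget top d58)
  rotation (across e Pq) = across e Ps
  rotation (across e Ps) = inBlock (suc e) PR
  rotation (across e sR) = across e sP
  rotation (across e sP) = inBlock (inject₁ e) SQ
  rotation (across e Rs) = inBlock (suc e) (gadget bot d58)


  vertexBase : Vertex k → Dart k
  vertexBase (i , s , j) = inBlock i (gadget s (gadgetVertexBase j))

  lastIndexAt : GVertex → Side → Fin (suc k) → ℕ
  lastIndexAt v3 top zero    = 5
  lastIndexAt v3 top (suc _) = 7
  lastIndexAt v3 bot i with view i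
  ... | ‵fromℕ     = 5
  ... | ‵inject₁ _ = 7
  lastIndexAt v5 top i with view i
  ... | ‵fromℕ     = 6
  ... | ‵inject₁ _ = 7
  lastIndexAt v5 bot zero    = 6
  lastIndexAt v5 bot (suc _) = 7
  lastIndexAt j s i = gadgetLastIndex j

  vertexLastIndex : Vertex k → ℕ
  vertexLastIndex (i , s , j) = lastIndexAt j s i

  vertexIndexInBlock : BlockDart → Fin (suc k) → ℕ
  vertexIndexInBlock (gadget s d) i = positionAtVertex d
  vertexIndexInBlock PR zero    = 5
  vertexIndexInBlock PR (suc _) = 7
  vertexIndexInBlock RP i = 6
  vertexIndexInBlock RQ i = 5
  vertexIndexInBlock QR i = 5
  vertexIndexInBlock QS i = 6
  vertexIndexInBlock SQ i with view i
  ... | ‵fromℕ     = 5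
  ... | ‵inject₁ _ = 7

  vertexIndex : Dart k → ℕ
  vertexIndex (inBlock i b) = vertexIndexInBlock b i
  vertexIndex (across e qP) = 7
  vertexIndex (across e Pq) = 5
  vertexIndex (across e sP) = 6
  vertexIndex (across e Ps) = 6
  vertexIndex (across e sR) = 5
  vertexIndex (across e Rs) = 7

  vertexOf-rotation : (x : Dart k) → vertexOf (rotation x) ≡ vertexOf x
  vertexOf-rotation (inBlock zero (gadget top d39)) = refl
  vertexOf-rotation (inBlock (suc e) (gadget top d39)) = refl
  vertexOf-rotation (inBlock i (gadget bot d39)) with view i
  ... | ‵fromℕ     = refl
  ... | ‵inject₁ e = refl
  vertexOf-rotation (inBlock i (gadget top d53)) = refl
  vertexOf-rotation (inBlock i (gadget bot d53)) = refl
  vertexOf-rotation (inBlock i (gadget s d01)) = refl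
  vertexOf-rotation (inBlock i (gadget s d10)) = refl
  vertexOf-rotation (inBlock i (gadget s d02)) = refl
  vertexOf-rotation (inBlock i (gadget s d20)) = refl
  vertexOf-rotation (inBlock i (gadget s d03)) = refl
  vertexOf-rotation (inBlock i (gadget s d30)) = refl
  vertexOf-rotation (inBlock i (gadget s d04)) = refl
  vertexOf-rotation (inBlock i (gadget s d40)) = refl
  vertexOf-rotation (inBlock i (gadget s d05)) = refl
  vertexOf-rotation (inBlock i (gadget s d50)) = refl
  vertexOf-rotation (inBlock i (gadget s d06)) = refl
  vertexOf-rotation (inBlock i (gadget s d60)) = refl
  vertexOf-rotation (inBlock i (gadget s d07)) = refl
  vertexOf-rotation (inBlock i (gadget s d70)) = refl
  vertexOf-rotation (inBlock i (gadget s d12)) = refl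
  vertexOf-rotation (inBlock i (gadget s d21)) = refl
  vertexOf-rotation (inBlock i (gadget s d23)) = refl
  vertexOf-rotation (inBlock i (gadget s d32)) = refl
  vertexOf-rotation (inBlock i (gadget s d34)) = refl
  vertexOf-rotation (inBlock i (gadget s d43)) = refl
  vertexOf-rotation (inBlock i (gadget s d45)) = refl
  vertexOf-rotation (inBlock i (gadget s d54)) = refl
  vertexOf-rotation (inBlock i (gadget s d56)) = refl
  vertexOf-rotation (inBlock i (gadget s d65)) = refl
  vertexOf-rotation (inBlock i (gadget s d67)) = refl
  vertexOf-rotation (inBlock i (gadget s d76)) = refl
  vertexOf-rotation (inBlock i (gadget s d19)) = refl
  vertexOf-rotation (inBlock i (gadget s d91)) = refl
  vertexOf-rotation (inBlock i (gadget s d29)) = refl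
  vertexOf-rotation (inBlock i (gadget s d92)) = refl
  vertexOf-rotation (inBlock i (gadget s d93)) = refl
  vertexOf-rotation (inBlock i (gadget s d35)) = refl
  vertexOf-rotation (inBlock i (gadget s d58)) = refl
  vertexOf-rotation (inBlock i (gadget s d85)) = refl
  vertexOf-rotation (inBlock i (gadget s d68)) = refl
  vertexOf-rotation (inBlock i (gadget s d86)) = refl
  vertexOf-rotation (inBlock i (gadget s d78)) = refl
  vertexOf-rotation (inBlock i (gadget s d87)) = refl
  vertexOf-rotation (inBlock i PR) = refl
  vertexOf-rotation (inBlock i QR) = refl
  vertexOf-rotation (inBlock i QS) with view i
  ... | ‵fromℕ     = refl
  ... | ‵inject₁ e = refl
  vertexOf-rotation (inBlock i SQ) = refl
  vertexOf-rotation (inBlock i RQ) = refl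
  vertexOf-rotation (inBlock zero RP) = refl
  vertexOf-rotation (inBlock (suc e) RP) = refl
  vertexOf-rotation (across e qP) = refl
  vertexOf-rotation (across e Pq) = refl
  vertexOf-rotation (across e Ps) = refl
  vertexOf-rotation (across e sR) = refl
  vertexOf-rotation (across e sP) = refl
  vertexOf-rotation (across e Rs) = refl

  vertexReach : (x : Dart k) → iter rotation (vertexIndex x) (vertexBase (vertexOf x)) ≡ x
  vertexReach (inBlock i (gadget s d01)) = refl
  vertexReach (inBlock i (gadget s d10)) = refl
  vertexReach (inBlock i (gadget s d02)) = refl
  vertexReach (inBlock i (gadget s d20)) = refl
  vertexReach (inBlock i (gadget s d03)) = refl
  vertexReach (inBlock i (gadget s d30)) = refl
  vertexReach (inBlock i (gadget s d04)) = refl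
  vertexReach (inBlock i (gadget s d40)) = refl
  vertexReach (inBlock i (gadget s d05)) = refl
  vertexReach (inBlock i (gadget s d50)) = refl
  vertexReach (inBlock i (gadget s d06)) = refl
  vertexReach (inBlock i (gadget s d60)) = refl
  vertexReach (inBlock i (gadget s d07)) = refl
  vertexReach (inBlock i (gadget s d70)) = refl
  vertexReach (inBlock i (gadget s d12)) = refl
  vertexReach (inBlock i (gadget s d21)) = refl
  vertexReach (inBlock i (gadget s d23)) = refl
  vertexReach (inBlock i (gadget s d32)) = refl
  vertexReach (inBlock i (gadget s d34)) = refl
  vertexReach (inBlock i (gadget s d43)) = refl
  vertexReach (inBlock i (gadget s d45)) = refl
  vertexReach (inBlock i (gadget s d54)) = refl
  vertexReach (inBlock i (gadget s d56)) = refl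
  vertexReach (inBlock i (gadget s d65)) = refl
  vertexReach (inBlock i (gadget s d67)) = refl
  vertexReach (inBlock i (gadget s d76)) = refl
  vertexReach (inBlock i (gadget s d19)) = refl
  vertexReach (inBlock i (gadget s d91)) = refl
  vertexReach (inBlock i (gadget s d29)) = refl
  vertexReach (inBlock i (gadget s d92)) = refl
  vertexReach (inBlock i (gadget s d93)) = refl
  vertexReach (inBlock i (gadget s d35)) = refl
  vertexReach (inBlock i (gadget s d85)) = refl
  vertexReach (inBlock i (gadget s d68)) = refl
  vertexReach (inBlock i (gadget s d86)) = refl
  vertexReach (inBlock i (gadget s d78)) = refl
  vertexReach (inBlock i (gadget s d87)) = refl
  vertexReach (inBlock zero (gadget top d39)) = refl
  vertexReach (inBlock (suc e) (gadget top d39)) = refl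
  vertexReach (inBlock i (gadget bot d39)) with view i
  ... | ‵fromℕ     = refl
  ... | ‵inject₁ e = refl
  vertexReach (inBlock i (gadget s d53)) = refl
  vertexReach (inBlock i (gadget top d58)) with view i
  ... | ‵fromℕ     = refl
  ... | ‵inject₁ e = refl
  vertexReach (inBlock zero (gadget bot d58)) = refl
  vertexReach (inBlock (suc e) (gadget bot d58)) = refl
  vertexReach (inBlock zero PR) = refl
  vertexReach (inBlock (suc e) PR) = refl
  vertexReach (inBlock zero RP) = refl
  vertexReach (inBlock (suc e) RP) = refl
  vertexReach (inBlock i RQ) = refl
  vertexReach (inBlock i QR) = refl
  vertexReach (inBlock i QS) with view i
  ... | ‵fromℕ     = refl
  ... | ‵inject₁ e = refl
  vertexReach (inBlock i SQ) with view i
  ... | ‵fromℕ     rewrite view-fromℕ k = refl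
  ... | ‵inject₁ e rewrite view-inject₁ e = refl
  vertexReach (across e qP) rewrite view-inject₁ e = refl
  vertexReach (across e Pq) = refl
  vertexReach (across e sP) rewrite view-inject₁ e = refl
  vertexReach (across e Ps) = refl
  vertexReach (across e sR) rewrite view-inject₁ e = refl
  vertexReach (across e Rs) = refl

  vertexCloses : (v : Vertex k) → iter rotation (suc (vertexLastIndex v)) (vertexBase v) ≡ vertexBase v
  vertexCloses (i , s , v0) = refl
  vertexCloses (i , s , v1) = refl
  vertexCloses (i , s , v2) = refl
  vertexCloses (i , s , v4) = refl
  vertexCloses (i , s , v6) = refl
  vertexCloses (i , s , v7) = refl
  vertexCloses (i , s , v8) = refl
  vertexCloses (i , s , v9) = refl
  vertexCloses (zero , top , v3) = refl
  vertexCloses (suc e , top , v3) = refl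
  vertexCloses (i , bot , v3) with view i
  ... | ‵fromℕ     rewrite view-fromℕ k = refl
  ... | ‵inject₁ e rewrite view-inject₁ e = refl
  vertexCloses (i , top , v5) with view i
  ... | ‵fromℕ     rewrite view-fromℕ k = refl
  ... | ‵inject₁ e rewrite view-inject₁ e = refl
  vertexCloses (zero , bot , v5) = refl
  vertexCloses (suc e , bot , v5) = refl

  vertexOrbits : OrbitPresentation rotation vertexOf
  vertexOrbits = record
    { cls-g = vertexOf-rotation
    ; base = vertexBase ; cls-base = λ { (i , s , j) → cong (λ j′ → i , s , j′) (source-vertexBase j) }
    ; index = vertexIndex ; reach = vertexReach
    ; lastIndex = vertexLastIndex ; closes = vertexCloses }


  gadgetFace : Fin (suc k) → Side → Maybe (Fin 11) → Face k
  gadgetFace i s (just t) = gadgetTriangle i s t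
  gadgetFace i s nothing  = outer

  faceOfInBlock : BlockDart → Fin (suc k) → Face k
  faceOfInBlock (gadget top d35) i = linkTriangle i zero
  faceOfInBlock (gadget bot d35) i = linkTriangle i (suc zero)
  faceOfInBlock (gadget s d) i = gadgetFace i s (triangleOf d)
  faceOfInBlock QR i = linkTriangle i zero
  faceOfInBlock RP i = linkTriangle i zero
  faceOfInBlock RQ i = linkTriangle i (suc zero)
  faceOfInBlock QS i = linkTriangle i (suc zero)
  faceOfInBlock PR zero    = outer
  faceOfInBlock PR (suc e) = crossTriangle e (suc zero)
  faceOfInBlock SQ i with view i
  ... | ‵fromℕ     = outer
  ... | ‵inject₁ e = crossTriangle e zero

  faceOf : Dart k → Face k
  faceOf (inBlock i b) = faceOfInBlock b i
  faceOf (across e qP) = crossTriangle e zero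
  faceOf (across e Ps) = crossTriangle e zero
  faceOf (across e sP) = crossTriangle e (suc zero)
  faceOf (across e Rs) = crossTriangle e (suc zero)
  faceOf (across e Pq) = outer
  faceOf (across e sR) = outer

  outerBase : Dart k
  outerBase = inBlock zero (gadget bot d58)

  faceBase : Face k → Dart k
  faceBase (gadgetTriangle i s t) = inBlock i (gadget s (triangleBase t))
  faceBase (linkTriangle i zero) = inBlock i (gadget top d35)
  faceBase (linkTriangle i (suc zero)) = inBlock i (gadget bot d35)
  faceBase (crossTriangle e zero) = across e qP
  faceBase (crossTriangle e (suc zero)) = across e sP
  faceBase outer = outerBase

  faceLastIndex : Face k → ℕ
  faceLastIndex outer = 13 + 14 * k
  faceLastIndex (gadgetTriangle _ _ _) = 2
  faceLastIndex (linkTriangle _ _) = 2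
  faceLastIndex (crossTriangle _ _) = 2

  -- The outer face runs along the bottom gadgets from block 0 to block k and back along the top
  -- gadgets, seven darts per gadget starting with d58.
  outerOffset : Side → Fin (suc k) → ℕ
  outerOffset bot i = 7 * toℕ i
  outerOffset top i = 7 * (k ∸ toℕ i) + 7 * suc k

  gadgetFaceIndex : Maybe (Fin 11) → Side → Fin (suc k) → ℕ → ℕ
  gadgetFaceIndex (just _) s i p = p
  gadgetFaceIndex nothing  s i p = p + outerOffset s i

  faceIndexInBlock : BlockDart → Fin (suc k) → ℕ
  faceIndexInBlock (gadget s d35) i = 0
  faceIndexInBlock (gadget s d) i = gadgetFaceIndex (triangleOf d) s i (positionInFace d)
  faceIndexInBlock PR zero    = 6 + outerOffset top zero
  faceIndexInBlock PR (suc e) = 1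
  faceIndexInBlock RP i = 2
  faceIndexInBlock RQ i = 1
  faceIndexInBlock QR i = 1
  faceIndexInBlock QS i = 2
  faceIndexInBlock SQ i with view i
  ... | ‵fromℕ     = 6 + outerOffset bot (fromℕ k)
  ... | ‵inject₁ _ = 2

  faceIndex : Dart k → ℕ
  faceIndex (inBlock i b) = faceIndexInBlock b i
  faceIndex (across e qP) = 0
  faceIndex (across e Pq) = 6 + outerOffset top (suc e)
  faceIndex (across e sP) = 0
  faceIndex (across e Ps) = 1
  faceIndex (across e sR) = 6 + outerOffset bot (inject₁ e)
  faceIndex (across e Rs) = 2

  faceStep : Dart k → Dart k
  faceStep x = rotation (opposite x)

  outerEntry : Side → Fin (suc k) → Dart k
  outerEntry s i = inBlock i (gadget s d58)

  bottomStep : ∀ e → iter faceStep 7 (outerEntry bot (inject₁ e)) ≡ outerEntry bot (suc e)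
  bottomStep e rewrite view-inject₁ e = refl

  bottomExit : ∀ e → iter faceStep 6 (outerEntry bot (inject₁ e)) ≡ across e sR
  bottomExit e rewrite view-inject₁ e = refl

  lastBottomExit : iter faceStep 6 (outerEntry bot (fromℕ k)) ≡ inBlock (fromℕ k) SQ
  lastBottomExit rewrite view-fromℕ k = refl

  lastBlockTurn : iter faceStep 7 (outerEntry bot (fromℕ k)) ≡ outerEntry top (fromℕ k)
  lastBlockTurn = trans (cong faceStep lastBottomExit) lastLink
    where
    lastLink : faceStep (inBlock (fromℕ k) SQ) ≡ outerEntry top (fromℕ k)
    lastLink rewrite view-fromℕ k = refl

  outerWalk : ∀ s i → iter faceStep (outerOffset s i) outerBase ≡ outerEntry s i
  outerWalk bot i = iter-chain faceStep 7 (outerEntry bot) bottomStep i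
  outerWalk top i = begin
    iter faceStep (back + 7 * suc k) outerBase                ≡⟨ iter-+ faceStep back (7 * suc k) outerBase ⟩
    iter faceStep back (iter faceStep (7 * suc k) outerBase)  ≡⟨ cong (iter faceStep back) aroundBottom ⟩
    iter faceStep back (outerEntry top (fromℕ k))             ≡⟨ iter-chain-down faceStep 7 (outerEntry top) (λ _ → refl) i ⟩
    outerEntry top i                                          ∎
    where
    open ≡-Reasoning
    back = 7 * (k ∸ toℕ i)
    aroundBottom : iter faceStep (7 * suc k) outerBase ≡ outerEntry top (fromℕ k)
    aroundBottom = begin
      iter faceStep (7 * suc k) outerBase               ≡⟨ cong (λ t → iter faceStep t outerBase) (*-suc 7 k) ⟩
      iter faceStep (7 + 7 * k) outerBase               ≡⟨ iter-+ faceStep 7 (7 * k) outerBase ⟩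
      iter faceStep 7 (iter faceStep (7 * k) outerBase) ≡⟨ cong (iter faceStep 7) bottomWalk ⟩
      iter faceStep 7 (outerEntry bot (fromℕ k))        ≡⟨ lastBlockTurn ⟩
      outerEntry top (fromℕ k)                          ∎
      where
      bottomWalk : iter faceStep (7 * k) outerBase ≡ outerEntry bot (fromℕ k)
      bottomWalk = subst (λ t → iter faceStep (7 * t) outerBase ≡ outerEntry bot (fromℕ k)) (toℕ-fromℕ k) (outerWalk bot (fromℕ k))

  outerCloses : iter faceStep (suc (13 + 14 * k)) outerBase ≡ outerBase
  outerCloses = begin
    iter faceStep (suc (13 + 14 * k)) outerBase                        ≡⟨ cong (λ t → iter faceStep t outerBase) (length k) ⟩
    iter faceStep 7 (iter faceStep (outerOffset top zero) outerBase)  ≡⟨ cong (iter faceStep 7) (outerWalk top zero) ⟩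
    iter faceStep 7 (outerEntry top zero)                              ≡⟨⟩
    outerBase                                                          ∎
    where
    open ≡-Reasoning
    length : ∀ k → suc (13 + 14 * k) ≡ 7 + (7 * k + 7 * suc k)
    length = solve-∀

  faceOf-faceStep : (x : Dart k) → faceOf (faceStep x) ≡ faceOf x
  faceOf-faceStep (inBlock i (gadget s d01)) = refl
  faceOf-faceStep (inBlock i (gadget s d10)) = refl
  faceOf-faceStep (inBlock i (gadget s d02)) = refl
  faceOf-faceStep (inBlock i (gadget s d20)) = refl
  faceOf-faceStep (inBlock i (gadget s d03)) = refl
  faceOf-faceStep (inBlock i (gadget s d30)) = refl
  faceOf-faceStep (inBlock i (gadget s d04)) = refl
  faceOf-faceStep (inBlock i (gadget s d40)) = refl
  faceOf-faceStep (inBlock i (gadget s d05)) = refl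
  faceOf-faceStep (inBlock i (gadget s d50)) = refl
  faceOf-faceStep (inBlock i (gadget s d06)) = refl
  faceOf-faceStep (inBlock i (gadget s d60)) = refl
  faceOf-faceStep (inBlock i (gadget s d07)) = refl
  faceOf-faceStep (inBlock i (gadget s d70)) = refl
  faceOf-faceStep (inBlock i (gadget s d12)) = refl
  faceOf-faceStep (inBlock i (gadget s d21)) = refl
  faceOf-faceStep (inBlock i (gadget s d23)) = refl
  faceOf-faceStep (inBlock i (gadget s d32)) = refl
  faceOf-faceStep (inBlock i (gadget s d34)) = refl
  faceOf-faceStep (inBlock i (gadget s d43)) = refl
  faceOf-faceStep (inBlock i (gadget s d45)) = refl
  faceOf-faceStep (inBlock i (gadget s d54)) = refl
  faceOf-faceStep (inBlock i (gadget s d56)) = refl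
  faceOf-faceStep (inBlock i (gadget s d65)) = refl
  faceOf-faceStep (inBlock i (gadget s d67)) = refl
  faceOf-faceStep (inBlock i (gadget s d76)) = refl
  faceOf-faceStep (inBlock i (gadget s d19)) = refl
  faceOf-faceStep (inBlock i (gadget s d91)) = refl
  faceOf-faceStep (inBlock i (gadget s d29)) = refl
  faceOf-faceStep (inBlock i (gadget s d92)) = refl
  faceOf-faceStep (inBlock zero (gadget top d39)) = refl
  faceOf-faceStep (inBlock (suc e) (gadget top d39)) = refl
  faceOf-faceStep (inBlock i (gadget bot d39)) with view i
  ... | ‵fromℕ     = refl
  ... | ‵inject₁ e = refl
  faceOf-faceStep (inBlock zero (gadget top d93)) = refl
  faceOf-faceStep (inBlock (suc e) (gadget top d93)) = refl
  faceOf-faceStep (inBlock i (gadget bot d93)) with view i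
  ... | ‵fromℕ     rewrite view-fromℕ k = refl
  ... | ‵inject₁ e = refl
  faceOf-faceStep (inBlock i (gadget top d35)) = refl
  faceOf-faceStep (inBlock i (gadget bot d35)) = refl
  faceOf-faceStep (inBlock i (gadget top d53)) = refl
  faceOf-faceStep (inBlock i (gadget bot d53)) = refl
  faceOf-faceStep (inBlock i (gadget top d58)) with view i
  ... | ‵fromℕ     = refl
  ... | ‵inject₁ e = refl
  faceOf-faceStep (inBlock zero (gadget bot d58)) = refl
  faceOf-faceStep (inBlock (suc e) (gadget bot d58)) = refl
  faceOf-faceStep (inBlock i (gadget s d85)) = refl
  faceOf-faceStep (inBlock i (gadget s d68)) = refl
  faceOf-faceStep (inBlock i (gadget s d86)) = refl
  faceOf-faceStep (inBlock i (gadget s d78)) = refl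
  faceOf-faceStep (inBlock i (gadget s d87)) = refl
  faceOf-faceStep (inBlock zero PR) = refl
  faceOf-faceStep (inBlock (suc e) PR) = refl
  faceOf-faceStep (inBlock zero RP) = refl
  faceOf-faceStep (inBlock (suc e) RP) = refl
  faceOf-faceStep (inBlock i RQ) = refl
  faceOf-faceStep (inBlock i QR) = refl
  faceOf-faceStep (inBlock i QS) with view i
  ... | ‵fromℕ     = refl
  ... | ‵inject₁ e = refl
  faceOf-faceStep (inBlock i SQ) with view i
  ... | ‵fromℕ     = refl
  ... | ‵inject₁ e = refl
  faceOf-faceStep (across e qP) = refl
  faceOf-faceStep (across e Pq) = refl
  faceOf-faceStep (across e sP) = refl
  faceOf-faceStep (across e Ps) rewrite view-inject₁ e = refl
  faceOf-faceStep (across e sR) = refl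
  faceOf-faceStep (across e Rs) = refl

  faceReach : (x : Dart k) → iter faceStep (faceIndex x) (faceBase (faceOf x)) ≡ x
  faceReach (inBlock i (gadget s d01)) = cong (iter faceStep 3) (outerWalk s i)
  faceReach (inBlock i (gadget s d10)) = refl
  faceReach (inBlock i (gadget s d02)) = refl
  faceReach (inBlock i (gadget s d20)) = refl
  faceReach (inBlock i (gadget s d03)) = refl
  faceReach (inBlock i (gadget s d30)) = refl
  faceReach (inBlock i (gadget s d04)) = refl
  faceReach (inBlock i (gadget s d40)) = refl
  faceReach (inBlock i (gadget s d05)) = refl
  faceReach (inBlock i (gadget s d50)) = refl
  faceReach (inBlock i (gadget s d06)) = refl
  faceReach (inBlock i (gadget s d60)) = refl
  faceReach (inBlock i (gadget s d07)) = refl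
  faceReach (inBlock i (gadget s d70)) = cong (iter faceStep 2) (outerWalk s i)
  faceReach (inBlock i (gadget s d12)) = refl
  faceReach (inBlock i (gadget s d21)) = refl
  faceReach (inBlock i (gadget s d23)) = refl
  faceReach (inBlock i (gadget s d32)) = refl
  faceReach (inBlock i (gadget s d34)) = refl
  faceReach (inBlock i (gadget s d43)) = refl
  faceReach (inBlock i (gadget s d45)) = refl
  faceReach (inBlock i (gadget s d54)) = refl
  faceReach (inBlock i (gadget s d56)) = refl
  faceReach (inBlock i (gadget s d65)) = refl
  faceReach (inBlock i (gadget s d67)) = refl
  faceReach (inBlock i (gadget s d76)) = refl
  faceReach (inBlock i (gadget s d19)) = cong (iter faceStep 4) (outerWalk s i)
  faceReach (inBlock i (gadget s d91)) = refl
  faceReach (inBlock i (gadget s d29)) = refl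
  faceReach (inBlock i (gadget s d92)) = refl
  faceReach (inBlock zero (gadget top d39)) = refl
  faceReach (inBlock (suc e) (gadget top d39)) = refl
  faceReach (inBlock i (gadget bot d39)) with view i
  ... | ‵fromℕ     = refl
  ... | ‵inject₁ e = refl
  faceReach (inBlock i (gadget s d93)) = cong (iter faceStep 5) (outerWalk s i)
  faceReach (inBlock i (gadget top d35)) = refl
  faceReach (inBlock i (gadget bot d35)) = refl
  faceReach (inBlock i (gadget top d53)) = refl
  faceReach (inBlock i (gadget bot d53)) = refl
  faceReach (inBlock i (gadget s d58)) = outerWalk s i
  faceReach (inBlock i (gadget s d85)) = refl
  faceReach (inBlock i (gadget s d68)) = refl
  faceReach (inBlock i (gadget s d86)) = refl
  faceReach (inBlock i (gadget s d78)) = refl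
  faceReach (inBlock i (gadget s d87)) = cong (iter faceStep 1) (outerWalk s i)
  faceReach (inBlock zero PR) = cong (iter faceStep 6) (outerWalk top zero)
  faceReach (inBlock (suc e) PR) = refl
  faceReach (inBlock zero RP) = refl
  faceReach (inBlock (suc e) RP) = refl
  faceReach (inBlock i RQ) = refl
  faceReach (inBlock i QR) = refl
  faceReach (inBlock i QS) with view i
  ... | ‵fromℕ     = refl
  ... | ‵inject₁ e = refl
  faceReach (inBlock i SQ) with view i
  ... | ‵fromℕ     = trans (cong (iter faceStep 6) (outerWalk bot (fromℕ k))) lastBottomExit
  ... | ‵inject₁ e = refl
  faceReach (across e qP) = refl
  faceReach (across e Pq) = cong (iter faceStep 6) (outerWalk top (suc e))
  faceReach (across e sP) = refl
  faceReach (across e Ps) = refl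
  faceReach (across e sR) = trans (cong (iter faceStep 6) (outerWalk bot (inject₁ e))) (bottomExit e)
  faceReach (across e Rs) = refl

  faceCloses : (f : Face k) → iter faceStep (suc (faceLastIndex f)) (faceBase f) ≡ faceBase f
  faceCloses (gadgetTriangle i s t0) = refl
  faceCloses (gadgetTriangle i s t1) = refl
  faceCloses (gadgetTriangle i s t2) = refl
  faceCloses (gadgetTriangle i s t3) = refl
  faceCloses (gadgetTriangle i s t4) = refl
  faceCloses (gadgetTriangle i s t5) = refl
  faceCloses (gadgetTriangle i s t6) = refl
  faceCloses (gadgetTriangle i s t7) = refl
  faceCloses (gadgetTriangle i s t8) = refl
  faceCloses (gadgetTriangle i s t9) = refl
  faceCloses (gadgetTriangle i s t10) = refl
  faceCloses (linkTriangle i zero) = refl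
  faceCloses (linkTriangle i (suc zero)) = refl
  faceCloses (crossTriangle e zero) rewrite view-inject₁ e = refl
  faceCloses (crossTriangle e (suc zero)) = refl
  faceCloses outer = outerCloses

  faceOrbits : OrbitPresentation faceStep faceOf
  faceOrbits = record
    { cls-g = faceOf-faceStep
    ; base = faceBase ; cls-base = faceOf-base
    ; index = faceIndex ; reach = faceReach
    ; lastIndex = faceLastIndex ; closes = faceCloses }
    where
    faceOf-base : (f : Face k) → faceOf (faceBase f) ≡ f
    faceOf-base (gadgetTriangle i s t0) = refl
    faceOf-base (gadgetTriangle i s t1) = refl
    faceOf-base (gadgetTriangle i s t2) = refl
    faceOf-base (gadgetTriangle i s t3) = refl
    faceOf-base (gadgetTriangle i s t4) = refl
    faceOf-base (gadgetTriangle i s t5) = refl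
    faceOf-base (gadgetTriangle i s t6) = refl
    faceOf-base (gadgetTriangle i s t7) = refl
    faceOf-base (gadgetTriangle i s t8) = refl
    faceOf-base (gadgetTriangle i s t9) = refl
    faceOf-base (gadgetTriangle i s t10) = refl
    faceOf-base (linkTriangle i zero) = refl
    faceOf-base (linkTriangle i (suc zero)) = refl
    faceOf-base (crossTriangle e zero) = refl
    faceOf-base (crossTriangle e (suc zero)) = refl
    faceOf-base outer = refl


  _≟ᵖ_ : (p q : Fin (suc k) × Side) → Dec (p ≡ q)
  _≟ᵖ_ = ≡-dec _≟_ _≟_

  linkOrCross : Fin (suc k) → Side → GVertex → Fin (suc k) → Side → GVertex → Dart k
  linkOrCross i top v3 _ bot v5 = inBlock i PR
  linkOrCross i bot v5 _ top v3 = inBlock i RP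
  linkOrCross i bot v5 _ top v5 = inBlock i RQ
  linkOrCross i top v5 _ bot v5 = inBlock i QR
  linkOrCross i top v5 _ bot v3 = inBlock i QS
  linkOrCross i bot v3 _ top v5 = inBlock i SQ
  linkOrCross _ top v5 (suc e) top v3 = across e qP
  linkOrCross (suc e) top v3 _ top v5 = across e Pq
  linkOrCross _ bot v3 (suc e) top v3 = across e sP
  linkOrCross (suc e) top v3 _ bot v3 = across e Ps
  linkOrCross _ bot v3 (suc e) bot v5 = across e sR
  linkOrCross (suc e) bot v5 _ bot v3 = across e Rs
  linkOrCross _ _ _ _ _ _ = outerBase

  decode : Vertex k → Vertex k → Dart k
  decode (i , s , a) (i′ , s′ , b) with (i , s) ≟ᵖ (i′ , s′)
  ... | yes _ = inBlock i (gadget s (dartBetween a b))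
  ... | no _  = linkOrCross i s a i′ s′ b

  decode-correct : (x : Dart k) → decode (vertexOf x) (vertexOf (opposite x)) ≡ x
  decode-correct (inBlock i (gadget s d)) with (i , s) ≟ᵖ (i , s)
  ... | yes _ = cong (λ d → inBlock i (gadget s d)) (dartBetween-correct d)
  ... | no ne = ⊥-elim (ne refl)
  decode-correct (inBlock i PR) with (i , top) ≟ᵖ (i , bot)
  ... | no _ = refl
  decode-correct (inBlock i RP) with (i , bot) ≟ᵖ (i , top)
  ... | no _ = refl
  decode-correct (inBlock i RQ) with (i , bot) ≟ᵖ (i , top)
  ... | no _ = refl
  decode-correct (inBlock i QR) with (i , top) ≟ᵖ (i , bot)
  ... | no _ = refl
  decode-correct (inBlock i QS) with (i , top) ≟ᵖ (i , bot)
  ... | no _ = refl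
  decode-correct (inBlock i SQ) with (i , bot) ≟ᵖ (i , top)
  ... | no _ = refl
  decode-correct (across e qP) with (inject₁ e , top) ≟ᵖ (suc e , top)
  ... | yes eq = ⊥-elim (inject₁≢suc e (cong proj₁ eq))
  ... | no _   = refl
  decode-correct (across e Pq) with (suc e , top) ≟ᵖ (inject₁ e , top)
  ... | yes eq = ⊥-elim (inject₁≢suc e (sym (cong proj₁ eq)))
  ... | no _   = refl
  decode-correct (across e sP) with (inject₁ e , bot) ≟ᵖ (suc e , top)
  ... | no _ = refl
  decode-correct (across e Ps) with (suc e , top) ≟ᵖ (inject₁ e , bot)
  ... | no _ = refl
  decode-correct (across e sR) with (inject₁ e , bot) ≟ᵖ (suc e , bot)
  ... | yes eq = ⊥-elim (inject₁≢suc e (cong proj₁ eq))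
  ... | no _   = refl
  decode-correct (across e Rs) with (suc e , bot) ≟ᵖ (inject₁ e , bot)
  ... | yes eq = ⊥-elim (inject₁≢suc e (sym (cong proj₁ eq)))
  ... | no _   = refl

  no-parallelEdges : (x y : Dart k) → vertexOf x ≡ vertexOf y → vertexOf (opposite x) ≡ vertexOf (opposite y) → x ≡ y
  no-parallelEdges x y same₁ same₂ = begin
    x                                           ≡⟨ sym (decode-correct x) ⟩
    decode (vertexOf x) (vertexOf (opposite x)) ≡⟨ cong₂ decode same₁ same₂ ⟩
    decode (vertexOf y) (vertexOf (opposite y)) ≡⟨ decode-correct y ⟩
    y                                           ∎
    where open ≡-Reasoning

  opposite-involutive : (x : Dart k) → opposite (opposite x) ≡ x
  opposite-involutive (inBlock i (gadget s (e , fwd))) = refl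
  opposite-involutive (inBlock i (gadget s (e , bwd))) = refl
  opposite-involutive (inBlock i PR) = refl
  opposite-involutive (inBlock i RP) = refl
  opposite-involutive (inBlock i RQ) = refl
  opposite-involutive (inBlock i QR) = refl
  opposite-involutive (inBlock i QS) = refl
  opposite-involutive (inBlock i SQ) = refl
  opposite-involutive (across e qP) = refl
  opposite-involutive (across e Pq) = refl
  opposite-involutive (across e sP) = refl
  opposite-involutive (across e Ps) = refl
  opposite-involutive (across e sR) = refl
  opposite-involutive (across e Rs) = refl

  no-loops : (x : Dart k) → vertexOf (opposite x) ≢ vertexOf x
  no-loops (inBlock i (gadget s (e , fwd))) eq = endpoints-distinct e (sym (cong (proj₂ ∘ proj₂) eq))
  no-loops (inBlock i (gadget s (e , bwd))) eq = endpoints-distinct e (cong (proj₂ ∘ proj₂) eq)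
  no-loops (inBlock i PR) ()
  no-loops (inBlock i RP) ()
  no-loops (inBlock i RQ) ()
  no-loops (inBlock i QR) ()
  no-loops (inBlock i QS) ()
  no-loops (inBlock i SQ) ()
  no-loops (across e qP) ()
  no-loops (across e Pq) ()
  no-loops (across e sP) ()
  no-loops (across e Ps) ()
  no-loops (across e sR) ()
  no-loops (across e Rs) ()

  opposite-fixedPointFree : (x : Dart k) → opposite x ≢ x
  opposite-fixedPointFree x eq = no-loops x (cong vertexOf eq)

module _ (k : ℕ) where

  dart↔Fin : Dart k ↔ Fin (suc k * ((20 * 2) * 2 + 6) + k * 6)
  dart↔Fin = (↔-refl ×ᶠ ((↔-refl ×ᶠ ↔-refl) ×ᶠ ↔-refl ⊎ᶠ ↔-refl)) ⊎ᶠ (↔-refl ×ᶠ ↔-refl)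

  vertex↔Fin : Vertex k ↔ Fin (suc k * (2 * 10))
  vertex↔Fin = ↔-refl ×ᶠ ↔-refl ×ᶠ ↔-refl

  face↔Fin : Face k ↔ Fin (suc k * (2 * 11 + 2) + (k * 2 + 1))
  face↔Fin = (↔-refl ×ᶠ (↔-refl ×ᶠ ↔-refl ⊎ᶠ ↔-refl)) ⊎ᶠ (↔-refl ×ᶠ ↔-refl) ⊎ᶠ ↔-refl

eulerFormula-chain : ∀ k → 2 * (suc k * (2 * 10)) + 2 * (suc k * (2 * 11 + 2) + (k * 2 + 1))
                         ≡ suc k * ((20 * 2) * 2 + 6) + k * 6 + 4
eulerFormula-chain = solve-∀

chainMap : ℕ → FinitePlaneMap
chainMap k = record
  { Dart = Dart k ; Vertex = Vertex k ; Face = Face k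
  ; dart↔Fin = dart↔Fin k ; vertex↔Fin = vertex↔Fin k ; face↔Fin = face↔Fin k
  ; opposite = opposite ; rotation = rotation ; vertexOf = vertexOf ; faceOf = faceOf
  ; opposite-involutive = opposite-involutive
  ; opposite-fixedPointFree = opposite-fixedPointFree
  ; vertexOrbits = vertexOrbits
  ; faceOrbits = faceOrbits
  ; no-loops = no-loops
  ; no-parallelEdges = no-parallelEdges
  ; eulerFormula = eulerFormula-chain k
  }

-- Minimum degree, triangular faces and 2-connectivity

module Chain (k : ℕ) where
  open PlaneGraphOf (chainMap k) public

  threeNeighbours : (v : Vertex k) → ThreeNeighbours v
  threeNeighbours (i , s , j) with firstNeighboursDistinct j
  ... | t₁≢t₂ , t₁≢t₃ , t₂≢t₃ = record
    { x₁ = inBlock i (gadget s b) ; x₂ = inBlock i (gadget s (turn b)) ; x₃ = inBlock i (gadget s (turn (turn b)))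
    ; x₁∈v = at b∈j
    ; x₂∈v = at (trans (source-turn b) b∈j)
    ; x₃∈v = at (trans (source-turn (turn b)) (trans (source-turn b) b∈j))
    ; far₁≢far₂ = t₁≢t₂ ∘ cong (proj₂ ∘ proj₂)
    ; far₁≢far₃ = t₁≢t₃ ∘ cong (proj₂ ∘ proj₂)
    ; far₂≢far₃ = t₂≢t₃ ∘ cong (proj₂ ∘ proj₂) }
    where
    b = gadgetVertexBase j
    b∈j = source-vertexBase j
    at : ∀ {j′} → j′ ≡ j → (i , s , j′) ≡ (i , s , j)
    at = cong (λ j′ → i , s , j′)

  minDegree : MinDegree≥3 G
  minDegree = minDegree≥3 threeNeighbours

  boundedFacesTriangular : ∀ x → face G x ≢ Faces.to outer → TriangularFaceAt G x
  boundedFacesTriangular x notOuter =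
    triangularFace G minDegree x (triangleOrbit x (boundedFace-lastIndex (faceOf (Darts.from x)) (notOuter ∘ cong Faces.to)))
    where
    boundedFace-lastIndex : (f : Face k) → f ≢ outer → faceLastIndex f ≡ 2
    boundedFace-lastIndex outer ≢outer = ⊥-elim (≢outer refl)
    boundedFace-lastIndex (gadgetTriangle _ _ _) _ = refl
    boundedFace-lastIndex (linkTriangle _ _) _ = refl
    boundedFace-lastIndex (crossTriangle _ _) _ = refl

localRank : Side → GVertex → ℕ
localRank top v3 = 0
localRank bot v5 = 1
localRank top v5 = 2
localRank bot v3 = 3
localRank top j  = internalRank j
localRank bot j  = 8 + internalRank j

LowerDartsSpec : GVertex → Set
LowerDartsSpec j = let (a , b) = lowerDarts j in
  source a ≡ j × source b ≡ j × target a ≢ target b ×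
  (∀ s → localRank s (target a) < localRank s j × localRank s (target b) < localRank s j)

lowerDarts-spec : ∀ j → Internal j → LowerDartsSpec j
lowerDarts-spec j (j≢3 , j≢5) = decided j j≢3 j≢5
  where
  decided = from-yes (all? λ j → ¬? (j ≟ v3) →-dec ¬? (j ≟ v5) →-dec
    (let (a , b) = lowerDarts j in
      (source a ≟ j) ×-dec (source b ≟ j) ×-dec ¬? (target a ≟ target b) ×-dec
      all? (λ s → (localRank s (target a) <? localRank s j) ×-dec (localRank s (target b) <? localRank s j))))

sameBlock< : ∀ {n} (i : Fin n) {a b} → a < b → 20 * toℕ i + a < 20 * toℕ i + b
sameBlock< i = +-monoʳ-< (20 * toℕ i)

nextBlock< : ∀ {k} (e : Fin k) {a} b → a < 20 → 20 * toℕ (inject₁ e) + a < 20 * toℕ (suc e) + b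
nextBlock< e {a} b a<20 = begin-strict
  20 * toℕ (inject₁ e) + a ≡⟨ cong (λ t → 20 * t + a) (toℕ-inject₁ e) ⟩
  20 * toℕ e + a           <⟨ +-monoʳ-< (20 * toℕ e) a<20 ⟩
  20 * toℕ e + 20          ≡⟨ trans (+-comm (20 * toℕ e) 20) (sym (*-suc 20 (toℕ e))) ⟩
  20 * suc (toℕ e)         ≤⟨ m≤m+n (20 * suc (toℕ e)) b ⟩
  20 * toℕ (suc e) + b     ∎
  where open ≤-Reasoning

module Connectivity (k : ℕ) where
  open Chain k

  rank : Vertex k → ℕ
  rank (i , s , j) = 20 * toℕ i + localRank s j

  root : Dart k
  root = inBlock zero PR

  internalLower : ∀ i s j → Internal j → TwoLowerNeighbours rank (i , s , j)
  internalLower i s j int with lowerDarts-spec j int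
  ... | a∈j , b∈j , ta≢tb , lower = record
    { x = inBlock i (gadget s (proj₁ (lowerDarts j))) ; y = inBlock i (gadget s (proj₂ (lowerDarts j)))
    ; x∈v = cong (λ j′ → i , s , j′) a∈j ; y∈v = cong (λ j′ → i , s , j′) b∈j
    ; far≢far = ta≢tb ∘ cong (proj₂ ∘ proj₂)
    ; x<v = sameBlock< i (proj₁ (lower s)) ; y<v = sameBlock< i (proj₂ (lower s)) }

  lowerNeighbours : ∀ v → v ≢ vertexOf root → v ≢ far root → TwoLowerNeighbours rank v
  lowerNeighbours (zero , top , v3) ≢root _ = ⊥-elim (≢root refl)
  lowerNeighbours (suc e , top , v3) _ _ = record
    { x = across e Pq ; y = across e Ps ; x∈v = refl ; y∈v = refl ; far≢far = λ ()
    ; x<v = nextBlock< e 0 (from-yes (2 <? 20)) ; y<v = nextBlock< e 0 (from-yes (3 <? 20)) }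
  lowerNeighbours (zero , bot , v5) _ ≢root = ⊥-elim (≢root refl)
  lowerNeighbours (suc e , bot , v5) _ _ = record
    { x = across e Rs ; y = inBlock (suc e) RP ; x∈v = refl ; y∈v = refl ; far≢far = λ ()
    ; x<v = nextBlock< e 1 (from-yes (3 <? 20)) ; y<v = sameBlock< (suc e) (from-yes (0 <? 1)) }
  lowerNeighbours (i , top , v5) _ _ = record
    { x = inBlock i QR ; y = inBlock i (gadget top d53) ; x∈v = refl ; y∈v = refl ; far≢far = λ ()
    ; x<v = sameBlock< i (from-yes (1 <? 2)) ; y<v = sameBlock< i (from-yes (0 <? 2)) }
  lowerNeighbours (i , bot , v3) _ _ = record
    { x = inBlock i SQ ; y = inBlock i (gadget bot d35) ; x∈v = refl ; y∈v = refl ; far≢far = λ ()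
    ; x<v = sameBlock< i (from-yes (2 <? 3)) ; y<v = sameBlock< i (from-yes (1 <? 3)) }
  lowerNeighbours (i , s , v0) _ _ = internalLower i s v0 ((λ ()) , (λ ()))
  lowerNeighbours (i , s , v1) _ _ = internalLower i s v1 ((λ ()) , (λ ()))
  lowerNeighbours (i , s , v2) _ _ = internalLower i s v2 ((λ ()) , (λ ()))
  lowerNeighbours (i , s , v4) _ _ = internalLower i s v4 ((λ ()) , (λ ()))
  lowerNeighbours (i , s , v6) _ _ = internalLower i s v6 ((λ ()) , (λ ()))
  lowerNeighbours (i , s , v7) _ _ = internalLower i s v7 ((λ ()) , (λ ()))
  lowerNeighbours (i , s , v8) _ _ = internalLower i s v8 ((λ ()) , (λ ()))
  lowerNeighbours (i , s , v9) _ _ = internalLower i s v9 ((λ ()) , (λ ()))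

  connected : TwoConnected G
  connected = twoConnected (s≤s (s≤s (s≤s z≤n))) rank root lowerNeighbours

-- The domination number

module Domination (k : ℕ) where
  open Chain k

  dominatingSet : Subset (suc k * (2 * 10))
  dominatingSet = concat (replicate (suc k) (concat (replicate 2 gadgetDominators)))

  ∣dominatingSet∣ : ∣ dominatingSet ∣ ≡ suc k * (2 * 3)
  ∣dominatingSet∣ = trans (∣concat-replicate∣ (suc k) (concat (replicate 2 gadgetDominators)))
                          (cong (suc k *_) (∣concat-replicate∣ 2 gadgetDominators))

  ∈-dominatingSet : ∀ i s {j} → j ∈ gadgetDominators → Vertices.to (i , s , j) ∈ dominatingSet
  ∈-dominatingSet i s j∈ = ∈-concat-replicate i (∈-concat-replicate s j∈)

  dominatingSet-dominates : Dominating G dominatingSet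
  dominatingSet-dominates = dominating dominatingSet dominatedAt
    where
    dominatedAt : ∀ v → DominatedBy dominatingSet v
    dominatedAt (i , s , j) with gadgetDominators-dominate j
    ... | inj₁ j∈ = inj₁ (∈-dominatingSet i s j∈)
    ... | inj₂ (d , refl , t∈) =
      inj₂ (inBlock i (gadget s (reverse d)) , cong (λ d′ → i , s , source d′) (reverse-involutive d) , ∈-dominatingSet i s t∈)

  localPart : Subset (suc k * (2 * 10)) → Fin (suc k) → Side → Subset 10
  localPart S i s = lookup (Blocks.blocks 2 10 (lookup (Blocks.blocks (suc k) (2 * 10) S) i)) s

  ∈-localPart : ∀ S {i s j} → Vertices.to (i , s , j) ∈ S → j ∈ localPart S i s
  ∈-localPart S {i} {s} v∈S =
    Blocks.∈-block 2 10 (lookup (Blocks.blocks (suc k) (2 * 10) S) i) s (Blocks.∈-block (suc k) (2 * 10) S i v∈S)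

  internalNeighbour : (x : Dart k) {i : Fin (suc k)} {s : Side} {j : GVertex} → far x ≡ (i , s , j) → Internal j →
    ∃[ d ] (source d ≡ j × vertexOf x ≡ (i , s , target d))
  internalNeighbour (inBlock i (gadget s d)) refl _ = reverse d , refl , cong (λ d′ → i , s , source d′) (sym (reverse-involutive d))
  internalNeighbour (inBlock i PR) refl (_ , j≢5) = ⊥-elim (j≢5 refl)
  internalNeighbour (inBlock i RP) refl (j≢3 , _) = ⊥-elim (j≢3 refl)
  internalNeighbour (inBlock i RQ) refl (_ , j≢5) = ⊥-elim (j≢5 refl)
  internalNeighbour (inBlock i QR) refl (_ , j≢5) = ⊥-elim (j≢5 refl)
  internalNeighbour (inBlock i QS) refl (j≢3 , _) = ⊥-elim (j≢3 refl)
  internalNeighbour (inBlock i SQ) refl (_ , j≢5) = ⊥-elim (j≢5 refl)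
  internalNeighbour (across e qP) refl (j≢3 , _) = ⊥-elim (j≢3 refl)
  internalNeighbour (across e Pq) refl (_ , j≢5) = ⊥-elim (j≢5 refl)
  internalNeighbour (across e sP) refl (j≢3 , _) = ⊥-elim (j≢3 refl)
  internalNeighbour (across e Ps) refl (j≢3 , _) = ⊥-elim (j≢3 refl)
  internalNeighbour (across e sR) refl (_ , j≢5) = ⊥-elim (j≢5 refl)
  internalNeighbour (across e Rs) refl (j≢3 , _) = ⊥-elim (j≢3 refl)

  localDominated : ∀ S → Dominating G S → ∀ i s j → Internal j → GadgetDominated (localPart S i s) j
  localDominated S dom i s j int = local (dominated S dom (i , s , j))
    where
    local : DominatedBy S (i , s , j) → GadgetDominated (localPart S i s) j
    local (inj₁ v∈S) = inj₁ (∈-localPart S {i} {s} {j} v∈S)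
    local (inj₂ (x , x→v , x∈S)) =
      let d , d-at , x-at = internalNeighbour x x→v int in
      inj₂ (d , d-at , ∈-localPart S {i} {s} {target d} (subst (λ v → Vertices.to v ∈ S) x-at x∈S))

  dominating-lowerBound : ∀ S → Dominating G S → suc k * (2 * 3) ≤ ∣ S ∣
  dominating-lowerBound S dom = Blocks.∣S∣-lowerBound (suc k) (2 * 10) S λ i →
    Blocks.∣S∣-lowerBound 2 10 (lookup (Blocks.blocks (suc k) (2 * 10) S) i) λ s →
      dominatesInternal⇒3≤∣p∣ (localPart S i s) (localDominated S dom i s)

  dominationNumber : DominationNumber G (suc k * (2 * 3))
  dominationNumber = (dominatingSet , dominatingSet-dominates , ∣dominatingSet∣) , dominating-lowerBound

mainTheorem9 : (N : ℕ) → Σ PlaneGraph λ G →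
    N ≤ n G × IsNearTriangulation G × MinDegree≥3 G ×
    Σ ℕ λ k → DominationNumber G k × 10 * k ≡ 3 * n G
mainTheorem9 N =
  G , ≤-trans (n≤1+n N) (m≤m*n (suc N) (2 * 10)) ,
  (connected , Faces.to outer , boundedFacesTriangular) , minDegree ,
  suc N * (2 * 3) , dominationNumber , ratio N
  where
  open Chain N
  open Connectivity N using (connected)
  open Domination N using (dominationNumber)
  ratio : ∀ N → 10 * (suc N * (2 * 3)) ≡ 3 * (suc N * (2 * 10))
  ratio = solve-∀
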